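{- Let $P$ be a closed typable program, i.e. $R;\Gamma\vdash P:\alpha$ for some $R,\Gamma,\alpha$ where every hypothesis of $\Gamma$ has the form $x:(u,\mathsf{Reg}_rA)$, and suppose there is no $P'$ with $P\to P'$. Then $P\equiv \nu x_1\cdots\nu x_m\,(M_1\mid\cdots\mid M_n\mid S_1\mid\cdots\mid S_p)$ for some $m,n,p\geq 0$, terms $M_i$ and stores $S_j$, where each $M_i$ is either a value or can be uniquely decomposed as $E[\mathsf{get}(y)]$ with $E$ an evaluation context, such that no value is associated with the address $y$ in the stores $S_1,\dots,S_p$ (i.e. none of them contains a component $y\Leftarrow V$ or $y\Leftarrow^pV$).
   Context: Programs. Variables $x,y,\dots$. Values $V ::= * \mid x \mid \lambda x.M \mid !V$. Terms $M ::= V \mid MM \mid !M \mid \mathsf{let}\ !x = M\ \mathsf{in}\ M \mid \nu x\,M \mid \mathsf{set}(x,V) \mid \mathsf{pset}(x,V) \mid \mathsf{get}(x) \mid (M \mid M)$. Stores $S ::= x \Leftarrow V \mid x \Leftarrow^{p} V \mid (S\mid S)$ (volatile and persistent stores). Programs $P ::= M \mid S \mid (P\mid P) \mid \nu x\,P$. Evaluation contexts $E ::= [\,] \mid EM \mid VE \mid !E \mid \mathsf{let}\ !x=E\ \mathsf{in}\ M$; static contexts $C ::= [\,] \mid (C\mid P) \mid (P \mid C) \mid \nu x\, C$. The binders $\lambda x$, $\nu x$, $\mathsf{let}\ !x$ bind $x$; $[V/x]$ is capture-avoiding substitution. Reduction. Structural equivalence $\equiv$ is the least equivalence relation on programs closed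 under static contexts and containing $\alpha$-renaming, $P\mid P'\equiv P'\mid P$, $(P\mid P')\mid P''\equiv P\mid(P'\mid P'')$, $(\nu x\,P)\mid P'\equiv \nu x(P\mid P')$ if $x\notin FV(P')$, and $E[\nu x\,M]\equiv \nu x\,E[M]$ if $x\notin FV(E)$. The basic rules $\Delta\to\Delta'$ are: $E[(\lambda x.M)V]\to E[[V/x]M]$; $E[\mathsf{let}\ !x = !V\ \mathsf{in}\ M]\to E[[V/x]M]$; $E[\mathsf{set}(x,V)]\to E[*]\mid x\Leftarrow V$; $E[\mathsf{pset}(x,V)]\to E[*]\mid x\Leftarrow^p V$; $E[\mathsf{get}(x)]\mid x\Leftarrow V\to E[V]$; $E[\mathsf{get}(x)]\mid x\Leftarrow^p !V \to E[!V]\mid x\Leftarrow^p !V$. Then $P\to P'$ iff $P\equiv C[\Delta]$ and $P'\equiv C[\Delta']$ for some static context $C$ and basic rule $\Delta\to\Delta'$. Types. Each region $r$ is (once and for all) either volatile or persistent. Types $\alpha ::= \mathbf{B} \mid A$, value types $A ::= \mathbf{1}\mid A\multimap\alpha \mid !A\mid \mathsf{Reg}_r A$. Partial sum $\uplus$ on $\{0,1,\infty\}$: $a\uplus 0=0\uplus a = a$, $\infty\uplus\infty=\infty$, undefined otherwise. A variable usage is $u\in\{1,\infty\}$; a region usage is a pair $U=(v,v')$ (output usage, input usage) belonging to one of the three families $\{(\infty,\infty)\}$, $\{(1,\infty),(0,\infty)\}$, $\{(0,0),(1,0),(0,1),(1,1)\}$; $U_1\uplus U_2$ is defined iff $U_1,U_2$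 lie in the same family and the componentwise sum is defined. A context is $\Gamma = x_1:(u_1,A_1),\dots,x_n:(u_n,A_n)$ with distinct variables; a region context is $R = r_1:(U_1,A_1),\dots,r_n:(U_n,A_n)$ with distinct regions. $\Gamma_1\uplus\Gamma_2$ is the union of the hypotheses, where $x:(u_1,A)\in\Gamma_1$ and $x:(u_2,A)\in\Gamma_2$ give $x:(u_1\uplus u_2,A)$ (undefined if the sum is undefined or the types differ). $R_1\uplus R_2$ is defined in the same componentwise way and requires equal domains; implicitly, a region $r:(U,A)$ present in only one of them is added to the other with the neutral usage of $U$'s family ($(\infty,\infty)$, $(0,\infty)$, $(0,0)$ respectively). Well-formedness. $R\models\alpha$ is the least relation with $R\models\mathbf 1$, $R\models \mathbf B$, $R\models A\multimap\alpha$ if $R\models A$ and $R\models\alpha$, $R\models !A$ if $R\models A$, and $R\models \mathsf{Reg}_rA$ if $r:(U,A)\in R$ for some $U$. $R\vdash$ iff $R\models A$ for all $r:(U,A)\in R$; $R\vdash\alpha$ iff $R\vdash$ and $R\models\alpha$; $R\vdash\Gamma$ iff $R\vdash A$ for all $x:(u,A)\in\Gamma$. Affinity. $\mathrm{aff}(x:(u,A))$ iff $u=1$; $\mathrm{aff}(r:((v,v'),A))$ iff $1\in\{v,v'\}$, or $r$ is volatile and $v'\neq0$. $\mathrm{aff}(R;\Gamma)$ iff at least one hypothesis of $R;\Gamma$ satisfies $\mathrm{aff}$; $\mathrm{saff}(R;\Gamma)$ iff all do. Typing. $R;\Gamma\vdash P:\alpha$ is the least relation closed under the rules: (var) $R\vdash\Gamma$,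 $x:(u,A)\in\Gamma$ $\Rightarrow$ $R;\Gamma\vdash x:A$; (unit) $R\vdash\Gamma$ $\Rightarrow$ $R;\Gamma\vdash *:\mathbf 1$; (abs) $R;\Gamma,x:(1,A)\vdash M:\alpha$ $\Rightarrow$ $R;\Gamma\vdash\lambda x.M:A\multimap\alpha$; (app) $R_1;\Gamma_1\vdash M:A\multimap\alpha$, $R_2;\Gamma_2\vdash N:A$ $\Rightarrow$ $R_1\uplus R_2;\Gamma_1\uplus\Gamma_2\vdash MN:\alpha$; (prom) $R\uplus R'\vdash \Gamma\uplus\Gamma'$, $\mathrm{saff}(R';\Gamma')$, $R;\Gamma\vdash M:A$, $\neg\mathrm{aff}(R;\Gamma)$ $\Rightarrow$ $R\uplus R';\Gamma\uplus\Gamma'\vdash !M:!A$; (let) $R_1;\Gamma_1\vdash M:!A$, $R_2;\Gamma_2,x:(\infty,A)\vdash N:\alpha$ $\Rightarrow$ $R_1\uplus R_2;\Gamma_1\uplus\Gamma_2\vdash \mathsf{let}\ !x=M\ \mathsf{in}\ N:\alpha$; (new) $R;\Gamma,x:(u,\mathsf{Reg}_rA)\vdash P:\alpha$ $\Rightarrow$ $R;\Gamma\vdash \nu x\,P:\alpha$; (get) $R\vdash\Gamma$, $x:(u,\mathsf{Reg}_rA)\in\Gamma$, $r:((v,v'),A)\in R$, $v'\neq0$ $\Rightarrow$ $R;\Gamma\vdash\mathsf{get}(x):A$; (set) if $\Gamma = x:(u,\mathsf{Reg}_rA)\uplus\Gamma'$, $r$ volatile, $R=r:((v,v'),A)\uplus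 R'$, $v\neq0$, $R\vdash\Gamma$, $R';\Gamma'\vdash V:A$, then $R;\Gamma\vdash\mathsf{set}(x,V):\mathbf 1$ and $R;\Gamma\vdash x\Leftarrow V:\mathbf B$; (pset) if $\Gamma = x:(u,\mathsf{Reg}_r!A)\uplus\Gamma'$, $r$ persistent, $R=r:((v,v'),!A)\uplus R'$, $v\neq0$, $R\vdash\Gamma$, $R';\Gamma'\vdash V:!A$, then $R;\Gamma\vdash\mathsf{pset}(x,V):\mathbf 1$ and $R;\Gamma\vdash x\Leftarrow^pV:\mathbf B$; (par-store) $R_1;\Gamma_1\vdash P:\alpha$, $R_2;\Gamma_2\vdash S:\mathbf B$ $\Rightarrow$ $R_1\uplus R_2;\Gamma_1\uplus\Gamma_2\vdash (P\mid S):\alpha$ and $R_1\uplus R_2;\Gamma_1\uplus\Gamma_2\vdash (S\mid P):\alpha$; (par) $R_i;\Gamma_i\vdash P_i:\alpha_i$ for $i=1,2$, with neither $P_1$ nor $P_2$ a store $\Rightarrow$ $R_1\uplus R_2;\Gamma_1\uplus\Gamma_2\vdash(P_1\mid P_2):\mathbf B$. -}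

module Defs where

open import Data.Nat using (ℕ; zero; suc; _+_; _≤_)
open import Data.Fin using (Fin; zero; suc; _≟_)
open import Data.Maybe using (Maybe; just; nothing; _>>=_)
open import Data.Product using (Σ; ∃; ∃-syntax; _×_; _,_; proj₁; proj₂)
open import Data.Sum using (_⊎_; inj₁; inj₂)
open import Data.List using (List; []; _∷_; _++_; map)
open import Data.List.Relation.Unary.All using (All)
open import Data.List.Membership.Propositional using (_∈_)
open import Relation.Nullary using (¬_; yes; no)
open import Relation.Binary.PropositionalEquality using (_≡_; _≢_)

-- Syntax (well-scoped de Bruijn indices; α-equivalent programs are
-- syntactically equal).

mutual
  data Val (n : ℕ) : Set where
    v* : Val n
    vvar : Fin n → Val n
    vlam : Term (suc n) → Val n
    v! : Val n → Val n

  -- terms  M ::= V | MM | !M | let !x = M in M | νx M | set(x,V)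
  --            | pset(x,V) | get(x) | (M | M)
  -- (the value forms *, x, λx.M are term constructors; the embedding of
  --  values into terms is the function ⌞_⌟ below, so !V as a term is
  --  represented uniquely as  `! ⌞ V ⌟)
  data Term (n : ℕ) : Set where
    `* : Term n
    `var : Fin n → Term n
    `lam : Term (suc n) → Term n
    `app : Term n → Term n → Term n
    `! : Term n → Term n
    `let! : Term n → Term (suc n) → Term n
    `ν : Term (suc n) → Term n
    `set : Fin n → Val n → Term n
    `pset : Fin n → Val n → Term n
    `get : Fin n → Term n
    `par : Term n → Term n → Term n

⌞_⌟ : ∀ {n} → Val n → Term n
⌞ v* ⌟ = `*
⌞ vvar x ⌟ = `var x
⌞ vlam M ⌟ = `lam M
⌞ v! V ⌟ = `! ⌞ V ⌟

data Prog (n : ℕ) : Set where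
  tm : Term n → Prog n
  sto : Fin n → Val n → Prog n
  psto : Fin n → Val n → Prog n
  par : Prog n → Prog n → Prog n
  ν : Prog (suc n) → Prog n

data IsStore {n : ℕ} : Prog n → Set where
  sto-store : ∀ x V → IsStore (sto x V)
  psto-store : ∀ x V → IsStore (psto x V)
  par-store : ∀ {S S'} → IsStore S → IsStore S' → IsStore (par S S')

data Binds {n : ℕ} (y : Fin n) : Prog n → Set where
  binds-sto : ∀ V → Binds y (sto y V)
  binds-psto : ∀ V → Binds y (psto y V)
  binds-parˡ : ∀ {S S'} → Binds y S → Binds y (par S S')
  binds-parʳ : ∀ {S S'} → Binds y S' → Binds y (par S S')

data ECtx (n : ℕ) : Set where
  hole : ECtx n
  appˡ : ECtx n → Term n → ECtx n
  appʳ : Val n → ECtx n → ECtx n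
  bang : ECtx n → ECtx n
  let! : ECtx n → Term (suc n) → ECtx n

_[_]ᴱ : ∀ {n} → ECtx n → Term n → Term n
hole [ M ]ᴱ = M
appˡ E N [ M ]ᴱ = `app (E [ M ]ᴱ) N
appʳ V E [ M ]ᴱ = `app ⌞ V ⌟ (E [ M ]ᴱ)
bang E [ M ]ᴱ = `! (E [ M ]ᴱ)
let! E N [ M ]ᴱ = `let! (E [ M ]ᴱ) N

-- static contexts  C ::= [] | (C | P) | (P | C) | νx C
-- (SCtx n m : outer scope n, scope of the hole m)
data SCtx : ℕ → ℕ → Set where
  hole : ∀ {n} → SCtx n n
  parˡ : ∀ {n m} → SCtx n m → Prog n → SCtx n m
  parʳ : ∀ {n m} → Prog n → SCtx n m → SCtx n m
  ν : ∀ {n m} → SCtx (suc n) m → SCtx n m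

_[_]ˢ : ∀ {n m} → SCtx n m → Prog m → Prog n
hole [ P ]ˢ = P
parˡ C Q [ P ]ˢ = par (C [ P ]ˢ) Q
parʳ Q C [ P ]ˢ = par Q (C [ P ]ˢ)
ν C [ P ]ˢ = ν (C [ P ]ˢ)

Ren : ℕ → ℕ → Set
Ren n m = Fin n → Fin m

extR : ∀ {n m} → Ren n m → Ren (suc n) (suc m)
extR ρ zero = zero
extR ρ (suc i) = suc (ρ i)

mutual
  renV : ∀ {n m} → Ren n m → Val n → Val m
  renV ρ v* = v*
  renV ρ (vvar x) = vvar (ρ x)
  renV ρ (vlam M) = vlam (renT (extR ρ) M)
  renV ρ (v! V) = v! (renV ρ V)

  renT : ∀ {n m} → Ren n m → Term n → Term m
  renT ρ `* = `*
  renT ρ (`var x) = `var (ρ x)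
  renT ρ (`lam M) = `lam (renT (extR ρ) M)
  renT ρ (`app M N) = `app (renT ρ M) (renT ρ N)
  renT ρ (`! M) = `! (renT ρ M)
  renT ρ (`let! M N) = `let! (renT ρ M) (renT (extR ρ) N)
  renT ρ (`ν M) = `ν (renT (extR ρ) M)
  renT ρ (`set x V) = `set (ρ x) (renV ρ V)
  renT ρ (`pset x V) = `pset (ρ x) (renV ρ V)
  renT ρ (`get x) = `get (ρ x)
  renT ρ (`par M N) = `par (renT ρ M) (renT ρ N)

renP : ∀ {n m} → Ren n m → Prog n → Prog m
renP ρ (tm M) = tm (renT ρ M)
renP ρ (sto x V) = sto (ρ x) (renV ρ V)
renP ρ (psto x V) = psto (ρ x) (renV ρ V)
renP ρ (par P Q) = par (renP ρ P) (renP ρ Q)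
renP ρ (ν P) = ν (renP (extR ρ) P)

renE : ∀ {n m} → Ren n m → ECtx n → ECtx m
renE ρ hole = hole
renE ρ (appˡ E N) = appˡ (renE ρ E) (renT ρ N)
renE ρ (appʳ V E) = appʳ (renV ρ V) (renE ρ E)
renE ρ (bang E) = bang (renE ρ E)
renE ρ (let! E N) = let! (renE ρ E) (renT (extR ρ) N)

Sub : ℕ → ℕ → Set
Sub n m = Fin n → Val m

extS : ∀ {n m} → Sub n m → Sub (suc n) (suc m)
extS σ zero = vvar zero
extS σ (suc i) = renV suc (σ i)

-- the address position of set/pset/get only admits a variable: substituting
-- any other value there does not yield a term (result  nothing)
asVar : ∀ {m} → Val m → Maybe (Fin m)
asVar (vvar x) = just x
asVar _ = nothing

mutual
  subV : ∀ {n m} → Sub n m → Val n → Maybe (Val m)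
  subV σ v* = just v*
  subV σ (vvar x) = just (σ x)
  subV σ (vlam M) = subT (extS σ) M >>= λ M' → just (vlam M')
  subV σ (v! V) = subV σ V >>= λ V' → just (v! V')

  subT : ∀ {n m} → Sub n m → Term n → Maybe (Term m)
  subT σ `* = just `*
  subT σ (`var x) = just ⌞ σ x ⌟
  subT σ (`lam M) = subT (extS σ) M >>= λ M' → just (`lam M')
  subT σ (`app M N) = subT σ M >>= λ M' → subT σ N >>= λ N' → just (`app M' N')
  subT σ (`! M) = subT σ M >>= λ M' → just (`! M')
  subT σ (`let! M N) = subT σ M >>= λ M' → subT (extS σ) N >>= λ N' → just (`let! M' N')
  subT σ (`ν M) = subT (extS σ) M >>= λ M' → just (`ν M')
  subT σ (`set x V) = asVar (σ x) >>= λ y → subV σ V >>= λ V' → just (`set y V')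
  subT σ (`pset x V) = asVar (σ x) >>= λ y → subV σ V >>= λ V' → just (`pset y V')
  subT σ (`get x) = asVar (σ x) >>= λ y → just (`get y)
  subT σ (`par M N) = subT σ M >>= λ M' → subT σ N >>= λ N' → just (`par M' N')

sub0 : ∀ {n} → Val n → Sub (suc n) n
sub0 V zero = V
sub0 V (suc i) = vvar i

_[_/0]≔_ : ∀ {n} → Term (suc n) → Val n → Term n → Set
M [ V /0]≔ M' = subT (sub0 V) M ≡ just M'

infix 4 _≈_
data _≈_ {n : ℕ} : Prog n → Prog n → Set where
  ≈-refl : ∀ {P} → P ≈ P
  ≈-sym : ∀ {P Q} → P ≈ Q → Q ≈ P
  ≈-trans : ∀ {P Q R} → P ≈ Q → Q ≈ R → P ≈ R
  ≈-ctx : ∀ {m} (C : SCtx n m) {P Q : Prog m} → P ≈ Q → C [ P ]ˢ ≈ C [ Q ]ˢ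
  ≈-comm : ∀ {P Q} → par P Q ≈ par Q P
  ≈-assoc : ∀ {P Q R} → par (par P Q) R ≈ par P (par Q R)
  -- (νx P) | P' ≡ νx (P | P')   (x ∉ FV(P') is built in by the shift)
  ≈-extr : ∀ {P : Prog (suc n)} {Q : Prog n} → par (ν P) Q ≈ ν (par P (renP suc Q))
  -- E[νx M] ≡ νx E[M]   (x ∉ FV(E) is built in by the shift)
  ≈-extrᴱ : ∀ {E : ECtx n} {M : Term (suc n)} →
            tm (E [ `ν M ]ᴱ) ≈ tm (`ν (renE suc E [ M ]ᴱ))
  -- the term (M | N) and the term νx M are also the programs (M | N), νx M
  -- (same string, two abstract-syntax trees here)
  ≈-tm-par : ∀ {M N} → tm (`par M N) ≈ par (tm M) (tm N)
  ≈-tm-ν : ∀ {M} → tm (`ν M) ≈ ν (tm M)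

infix 4 _⇒ᵇ_
data _⇒ᵇ_ {n : ℕ} : Prog n → Prog n → Set where
  β : ∀ (E : ECtx n) M V {M'} → M [ V /0]≔ M' →
      tm (E [ `app (`lam M) ⌞ V ⌟ ]ᴱ) ⇒ᵇ tm (E [ M' ]ᴱ)
  β! : ∀ (E : ECtx n) V M {M'} → M [ V /0]≔ M' →
       tm (E [ `let! (`! ⌞ V ⌟) M ]ᴱ) ⇒ᵇ tm (E [ M' ]ᴱ)
  set : ∀ (E : ECtx n) x V →
        tm (E [ `set x V ]ᴱ) ⇒ᵇ par (tm (E [ `* ]ᴱ)) (sto x V)
  pset : ∀ (E : ECtx n) x V →
         tm (E [ `pset x V ]ᴱ) ⇒ᵇ par (tm (E [ `* ]ᴱ)) (psto x V)
  get : ∀ (E : ECtx n) x V →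
        par (tm (E [ `get x ]ᴱ)) (sto x V) ⇒ᵇ tm (E [ ⌞ V ⌟ ]ᴱ)
  pget : ∀ (E : ECtx n) x V →
         par (tm (E [ `get x ]ᴱ)) (psto x (v! V))
           ⇒ᵇ par (tm (E [ ⌞ v! V ⌟ ]ᴱ)) (psto x (v! V))

infix 4 _⟶_
_⟶_ : ∀ {n} → Prog n → Prog n → Set
_⟶_ {n} P P' = Σ ℕ λ m → Σ (SCtx n m) λ C → Σ (Prog m) λ Δ → Σ (Prog m) λ Δ' →
  (Δ ⇒ᵇ Δ') × (P ≈ C [ Δ ]ˢ) × (P' ≈ C [ Δ' ]ˢ)

Region : Set
Region = ℕ

data Kind : Set where
  volatile persistent : Kind

mutual
  data VTy : Set where
    𝟏 : VTy
    _⊸_ : VTy → Ty → VTy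
    !ᵗ : VTy → VTy
    Reg : Region → VTy → VTy

  data Ty : Set where
    𝐁 : Ty
    ⌜_⌝ : VTy → Ty

data Mult : Set where
  𝟘 𝟙 ∞ : Mult

data _⊕_≔_ : Mult → Mult → Mult → Set where
  0⊕ : ∀ {a} → 𝟘 ⊕ a ≔ a
  ⊕0 : ∀ {a} → a ⊕ 𝟘 ≔ a
  ∞⊕∞ : ∞ ⊕ ∞ ≔ ∞

data VUse : Set where
  one inf : VUse

data _⊕ᵛ_≔_ : VUse → VUse → VUse → Set where
  inf⊕inf : inf ⊕ᵛ inf ≔ inf

-- region usages (v,v'): exactly the pairs of the three families
data RUse : Set where
  u∞∞ : RUse
  u1∞ u0∞ : RUse
  u00 u10 u01 u11 : RUse

out inp : RUse → Mult
out u∞∞ = ∞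
out u1∞ = 𝟙
out u0∞ = 𝟘
out u00 = 𝟘
out u10 = 𝟙
out u01 = 𝟘
out u11 = 𝟙
inp u∞∞ = ∞
inp u1∞ = ∞
inp u0∞ = ∞
inp u00 = 𝟘
inp u10 = 𝟘
inp u01 = 𝟙
inp u11 = 𝟙

data Family : Set where
  F₁ F₂ F₃ : Family

fam : RUse → Family
fam u∞∞ = F₁
fam u1∞ = F₂
fam u0∞ = F₂
fam u00 = F₃
fam u10 = F₃
fam u01 = F₃
fam u11 = F₃

record _⊕ᵁ_≔_ (U₁ U₂ U : RUse) : Set where
  field
    same-family : fam U₁ ≡ fam U₂
    out-sum : out U₁ ⊕ out U₂ ≔ out U
    inp-sum : inp U₁ ⊕ inp U₂ ≔ inp U

VHyp : Set
VHyp = VUse × VTy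

RHyp : Set
RHyp = RUse × VTy

Ctx : ℕ → Set
Ctx n = Fin n → Maybe VHyp

RCtx : Set
RCtx = Region → Maybe RHyp

FiniteSupport : RCtx → Set
FiniteSupport R = ∃[ b ] (∀ r → b ≤ r → R r ≡ nothing)

_▷_ : ∀ {n} → Ctx n → VHyp → Ctx (suc n)
(Γ ▷ h) zero = just h
(Γ ▷ h) (suc i) = Γ i

[_↦_] : ∀ {n} → Fin n → VHyp → Ctx n
[ x ↦ h ] i with i ≟ x
... | yes _ = just h
... | no _ = nothing

[_↦ʳ_] : Region → RHyp → RCtx
[ r ↦ʳ h ] r' with r' Data.Nat.≟ r
... | yes _ = just h
... | no _ = nothing

-- pointwise union of hypotheses; a hypothesis present on one side only
-- is kept (for regions: summed with the neutral usage of its family,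
-- which leaves it unchanged)
data VHypSum : Maybe VHyp → Maybe VHyp → Maybe VHyp → Set where
  none : VHypSum nothing nothing nothing
  left : ∀ h → VHypSum (just h) nothing (just h)
  right : ∀ h → VHypSum nothing (just h) (just h)
  both : ∀ {u₁ u₂ u A} → u₁ ⊕ᵛ u₂ ≔ u →
         VHypSum (just (u₁ , A)) (just (u₂ , A)) (just (u , A))

data RHypSum : Maybe RHyp → Maybe RHyp → Maybe RHyp → Set where
  none : RHypSum nothing nothing nothing
  left : ∀ h → RHypSum (just h) nothing (just h)
  right : ∀ h → RHypSum nothing (just h) (just h)
  both : ∀ {U₁ U₂ U A} → U₁ ⊕ᵁ U₂ ≔ U →
         RHypSum (just (U₁ , A)) (just (U₂ , A)) (just (U , A))

_⊎ᶜ_≔_ : ∀ {n} → Ctx n → Ctx n → Ctx n → Set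
Γ₁ ⊎ᶜ Γ₂ ≔ Γ = ∀ i → VHypSum (Γ₁ i) (Γ₂ i) (Γ i)

_⊎ᴿ_≔_ : RCtx → RCtx → RCtx → Set
R₁ ⊎ᴿ R₂ ≔ R = ∀ r → RHypSum (R₁ r) (R₂ r) (R r)

mutual
  data _⊨ᵛ_ (R : RCtx) : VTy → Set where
    wf𝟏 : R ⊨ᵛ 𝟏
    wf⊸ : ∀ {A α} → R ⊨ᵛ A → R ⊨ α → R ⊨ᵛ (A ⊸ α)
    wf! : ∀ {A} → R ⊨ᵛ A → R ⊨ᵛ !ᵗ A
    wfReg : ∀ {r A} U → R r ≡ just (U , A) → R ⊨ᵛ Reg r A

  data _⊨_ (R : RCtx) : Ty → Set where
    wf𝐁 : R ⊨ 𝐁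
    wf⌜⌝ : ∀ {A} → R ⊨ᵛ A → R ⊨ ⌜ A ⌝

WfR : RCtx → Set
WfR R = ∀ r U A → R r ≡ just (U , A) → R ⊨ᵛ A

WfTy : RCtx → VTy → Set
WfTy R A = WfR R × R ⊨ᵛ A

WfCtx : ∀ {n} → RCtx → Ctx n → Set
WfCtx R Γ = ∀ i u A → Γ i ≡ just (u , A) → WfTy R A

-- Affinity (depends on the fixed volatile/persistent kind of regions)

module _ (κ : Region → Kind) where

  affV : VHyp → Set
  affV (u , A) = u ≡ one

  affR : Region → RHyp → Set
  affR r (U , A) = out U ≡ 𝟙 ⊎ inp U ≡ 𝟙 ⊎ (κ r ≡ volatile × inp U ≢ 𝟘)

  aff : ∀ {n} → RCtx → Ctx n → Set
  aff R Γ = (∃[ i ] ∃[ h ] (Γ i ≡ just h × affV h))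
          ⊎ (∃[ r ] ∃[ h ] (R r ≡ just h × affR r h))

  saff : ∀ {n} → RCtx → Ctx n → Set
  saff R Γ = (∀ i h → Γ i ≡ just h → affV h)
           × (∀ r h → R r ≡ just h → affR r h)

  data _⨾_⊢_∶_ {n : ℕ} : RCtx → Ctx n → Prog n → Ty → Set where
    t-var : ∀ {R Γ x u A} → WfCtx R Γ → Γ x ≡ just (u , A) →
            R ⨾ Γ ⊢ tm (`var x) ∶ ⌜ A ⌝
    t-unit : ∀ {R Γ} → WfCtx R Γ → R ⨾ Γ ⊢ tm `* ∶ ⌜ 𝟏 ⌝
    t-abs : ∀ {R Γ A α M} → R ⨾ (Γ ▷ (one , A)) ⊢ tm M ∶ α →
            R ⨾ Γ ⊢ tm (`lam M) ∶ ⌜ A ⊸ α ⌝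
    t-app : ∀ {R₁ R₂ R Γ₁ Γ₂ Γ M N A α} →
            R₁ ⊎ᴿ R₂ ≔ R → Γ₁ ⊎ᶜ Γ₂ ≔ Γ →
            R₁ ⨾ Γ₁ ⊢ tm M ∶ ⌜ A ⊸ α ⌝ → R₂ ⨾ Γ₂ ⊢ tm N ∶ ⌜ A ⌝ →
            R ⨾ Γ ⊢ tm (`app M N) ∶ α
    t-prom : ∀ {R R' R'' Γ Γ' Γ'' M A} →
             R ⊎ᴿ R' ≔ R'' → Γ ⊎ᶜ Γ' ≔ Γ'' → WfCtx R'' Γ'' →
             saff R' Γ' → R ⨾ Γ ⊢ tm M ∶ ⌜ A ⌝ → ¬ aff R Γ →
             R'' ⨾ Γ'' ⊢ tm (`! M) ∶ ⌜ !ᵗ A ⌝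
    t-let : ∀ {R₁ R₂ R Γ₁ Γ₂ Γ M N A α} →
            R₁ ⊎ᴿ R₂ ≔ R → Γ₁ ⊎ᶜ Γ₂ ≔ Γ →
            R₁ ⨾ Γ₁ ⊢ tm M ∶ ⌜ !ᵗ A ⌝ → R₂ ⨾ (Γ₂ ▷ (inf , A)) ⊢ tm N ∶ α →
            R ⨾ Γ ⊢ tm (`let! M N) ∶ α
    t-new : ∀ {R Γ u r A α P} → R ⨾ (Γ ▷ (u , Reg r A)) ⊢ P ∶ α →
            R ⨾ Γ ⊢ ν P ∶ α
    t-newᵗ : ∀ {R Γ u r A α M} → R ⨾ (Γ ▷ (u , Reg r A)) ⊢ tm M ∶ α →
             R ⨾ Γ ⊢ tm (`ν M) ∶ α
    t-get : ∀ {R Γ x u r A U} → WfCtx R Γ → Γ x ≡ just (u , Reg r A) →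
            R r ≡ just (U , A) → inp U ≢ 𝟘 →
            R ⨾ Γ ⊢ tm (`get x) ∶ ⌜ A ⌝
    t-set : ∀ {R R' Γ Γ' x u r U A V} →
            [ x ↦ (u , Reg r A) ] ⊎ᶜ Γ' ≔ Γ → κ r ≡ volatile →
            [ r ↦ʳ (U , A) ] ⊎ᴿ R' ≔ R → out U ≢ 𝟘 → WfCtx R Γ →
            R' ⨾ Γ' ⊢ tm ⌞ V ⌟ ∶ ⌜ A ⌝ →
            R ⨾ Γ ⊢ tm (`set x V) ∶ ⌜ 𝟏 ⌝
    t-sto : ∀ {R R' Γ Γ' x u r U A V} →
            [ x ↦ (u , Reg r A) ] ⊎ᶜ Γ' ≔ Γ → κ r ≡ volatile →
            [ r ↦ʳ (U , A) ] ⊎ᴿ R' ≔ R → out U ≢ 𝟘 → WfCtx R Γ →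
            R' ⨾ Γ' ⊢ tm ⌞ V ⌟ ∶ ⌜ A ⌝ →
            R ⨾ Γ ⊢ sto x V ∶ 𝐁
    t-pset : ∀ {R R' Γ Γ' x u r U A V} →
             [ x ↦ (u , Reg r (!ᵗ A)) ] ⊎ᶜ Γ' ≔ Γ → κ r ≡ persistent →
             [ r ↦ʳ (U , !ᵗ A) ] ⊎ᴿ R' ≔ R → out U ≢ 𝟘 → WfCtx R Γ →
             R' ⨾ Γ' ⊢ tm ⌞ V ⌟ ∶ ⌜ !ᵗ A ⌝ →
             R ⨾ Γ ⊢ tm (`pset x V) ∶ ⌜ 𝟏 ⌝
    t-psto : ∀ {R R' Γ Γ' x u r U A V} →
             [ x ↦ (u , Reg r (!ᵗ A)) ] ⊎ᶜ Γ' ≔ Γ → κ r ≡ persistent →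
             [ r ↦ʳ (U , !ᵗ A) ] ⊎ᴿ R' ≔ R → out U ≢ 𝟘 → WfCtx R Γ →
             R' ⨾ Γ' ⊢ tm ⌞ V ⌟ ∶ ⌜ !ᵗ A ⌝ →
             R ⨾ Γ ⊢ psto x V ∶ 𝐁
    t-par-storeʳ : ∀ {R₁ R₂ R Γ₁ Γ₂ Γ P S α} →
                   R₁ ⊎ᴿ R₂ ≔ R → Γ₁ ⊎ᶜ Γ₂ ≔ Γ → IsStore S →
                   R₁ ⨾ Γ₁ ⊢ P ∶ α → R₂ ⨾ Γ₂ ⊢ S ∶ 𝐁 →
                   R ⨾ Γ ⊢ par P S ∶ α
    t-par-storeˡ : ∀ {R₁ R₂ R Γ₁ Γ₂ Γ P S α} →
                   R₁ ⊎ᴿ R₂ ≔ R → Γ₁ ⊎ᶜ Γ₂ ≔ Γ → IsStore S →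
                   R₁ ⨾ Γ₁ ⊢ P ∶ α → R₂ ⨾ Γ₂ ⊢ S ∶ 𝐁 →
                   R ⨾ Γ ⊢ par S P ∶ α
    t-par : ∀ {R₁ R₂ R Γ₁ Γ₂ Γ P₁ P₂ α₁ α₂} →
            R₁ ⊎ᴿ R₂ ≔ R → Γ₁ ⊎ᶜ Γ₂ ≔ Γ → ¬ IsStore P₁ → ¬ IsStore P₂ →
            R₁ ⨾ Γ₁ ⊢ P₁ ∶ α₁ → R₂ ⨾ Γ₂ ⊢ P₂ ∶ α₂ →
            R ⨾ Γ ⊢ par P₁ P₂ ∶ 𝐁
    -- (par) for the term (M | N)  (terms are never stores)
    t-parᵗ : ∀ {R₁ R₂ R Γ₁ Γ₂ Γ M₁ M₂ α₁ α₂} →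
             R₁ ⊎ᴿ R₂ ≔ R → Γ₁ ⊎ᶜ Γ₂ ≔ Γ →
             R₁ ⨾ Γ₁ ⊢ tm M₁ ∶ α₁ → R₂ ⨾ Γ₂ ⊢ tm M₂ ∶ α₂ →
             R ⨾ Γ ⊢ tm (`par M₁ M₂) ∶ 𝐁

νs : ∀ m {n} → Prog (m + n) → Prog n
νs zero P = P
νs (suc m) P = νs m (ν P)

pars : ∀ {n} → Prog n → List (Prog n) → Prog n
pars P [] = P
pars P (Q ∷ Qs) = par P (pars Q Qs)

IsValue : ∀ {n} → Term n → Set
IsValue {n} M = ∃[ V ] (M ≡ ⌞_⌟ {n} V)

StuckOnGet : ∀ {n} → List (Prog n) → Term n → Set
StuckOnGet {n} Ss M =
  Σ (ECtx n) λ E → Σ (Fin n) λ y →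
    (M ≡ E [ `get y ]ᴱ)
    × (∀ (E' : ECtx n) (y' : Fin n) → M ≡ E' [ `get y' ]ᴱ → E' ≡ E × y' ≡ y)
    × (∀ {S} → S ∈ Ss → ¬ Binds y S)

-- Up to structural equivalence, a typed program whose free variables are region addresses is
-- ν-binders over a parallel composition of terms and store cells: ν's are extruded out of
-- evaluation contexts and parallel compositions, and every term is driven to E[D] with D a
-- value, a get or a redex. Typing makes each β- or let-redex fire: an address position only
-- ever holds a region-typed variable, and a value of region type is a variable, so the
-- substitution is defined. Hence a stuck program has no redex left, and no E[get(y)] can have
-- a store for y in parallel, since structural equivalence would bring the two together.

module Submission where

open import Defs
open import Data.Nat using (ℕ; zero; suc; _+_)
open import Data.Fin using (Fin; zero; suc)
import Data.Fin as Fin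
open import Data.Maybe using (Maybe; just; nothing)
import Data.Maybe as Maybe
open import Data.Maybe.Properties using (just-injective)
open import Data.Product using (Σ; ∃-syntax; _×_; _,_; proj₂; map₁)
open import Data.Product.Properties using (,-injectiveˡ; ,-injectiveʳ)
open import Data.Sum using (_⊎_; inj₁; inj₂)
open import Data.List using (List; []; _∷_; _++_; map)
open import Data.List.Properties using (map-++; ++-assoc)
open import Data.List.Relation.Unary.All as All using (All; []; _∷_)
open import Data.List.Relation.Unary.All.Properties using (++⁺; gmap⁺)
open import Data.List.Relation.Unary.Any using (here; there)
open import Data.List.Membership.Propositional using (_∈_)
open import Data.List.Membership.Propositional.Properties using (∈-++⁺ˡ; ∈-++⁺ʳ; ∈-map⁺; ∈-∃++)
open import Data.List.Relation.Binary.Permutation.Propositional as ↭ using (_↭_)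
open import Data.List.Relation.Binary.Permutation.Propositional.Properties
  using (↭-empty-inv; ∈-resp-↭; ++⁺ˡ; shift; shifts)
open import Data.Unit using (⊤; tt)
open import Data.Empty using (⊥-elim)
open import Function using (_∘_; id)
open import Relation.Nullary using (¬_; yes; no)
open import Relation.Binary.PropositionalEquality
  using (_≡_; _≢_; _≗_; refl; sym; trans; cong; cong₂; subst; subst₂)
open import Relation.Binary.Bundles using (Setoid)
import Relation.Binary.Reasoning.Setoid

renT-⌞⌟ : ∀ {n m} (ρ : Ren n m) (V : Val n) → renT ρ ⌞ V ⌟ ≡ ⌞ renV ρ V ⌟
renT-⌞⌟ ρ v* = refl
renT-⌞⌟ ρ (vvar x) = refl
renT-⌞⌟ ρ (vlam M) = refl
renT-⌞⌟ ρ (v! V) = cong `! (renT-⌞⌟ ρ V)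

renT-plug : ∀ {n m} (ρ : Ren n m) (E : ECtx n) M → renT ρ (E [ M ]ᴱ) ≡ renE ρ E [ renT ρ M ]ᴱ
renT-plug ρ hole M = refl
renT-plug ρ (appˡ E N) M = cong (λ X → `app X (renT ρ N)) (renT-plug ρ E M)
renT-plug ρ (appʳ V E) M = cong₂ `app (renT-⌞⌟ ρ V) (renT-plug ρ E M)
renT-plug ρ (bang E) M = cong `! (renT-plug ρ E M)
renT-plug ρ (let! E N) M = cong (λ X → `let! X (renT (extR ρ) N)) (renT-plug ρ E M)

extR-cong : ∀ {n m} {ρ ρ' : Ren n m} → ρ ≗ ρ' → extR ρ ≗ extR ρ'
extR-cong h zero = refl
extR-cong h (suc i) = cong suc (h i)

mutual
  renV-cong : ∀ {n m} {ρ ρ' : Ren n m} → ρ ≗ ρ' → renV ρ ≗ renV ρ'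
  renV-cong h v* = refl
  renV-cong h (vvar x) = cong vvar (h x)
  renV-cong h (vlam M) = cong vlam (renT-cong (extR-cong h) M)
  renV-cong h (v! V) = cong v! (renV-cong h V)

  renT-cong : ∀ {n m} {ρ ρ' : Ren n m} → ρ ≗ ρ' → renT ρ ≗ renT ρ'
  renT-cong h `* = refl
  renT-cong h (`var x) = cong `var (h x)
  renT-cong h (`lam M) = cong `lam (renT-cong (extR-cong h) M)
  renT-cong h (`app M N) = cong₂ `app (renT-cong h M) (renT-cong h N)
  renT-cong h (`! M) = cong `! (renT-cong h M)
  renT-cong h (`let! M N) = cong₂ `let! (renT-cong h M) (renT-cong (extR-cong h) N)
  renT-cong h (`ν M) = cong `ν (renT-cong (extR-cong h) M)
  renT-cong h (`set x V) = cong₂ `set (h x) (renV-cong h V)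
  renT-cong h (`pset x V) = cong₂ `pset (h x) (renV-cong h V)
  renT-cong h (`get x) = cong `get (h x)
  renT-cong h (`par M N) = cong₂ `par (renT-cong h M) (renT-cong h N)

extR-∘ : ∀ {n m k} (ρ' : Ren m k) (ρ : Ren n m) → extR ρ' ∘ extR ρ ≗ extR (ρ' ∘ ρ)
extR-∘ ρ' ρ zero = refl
extR-∘ ρ' ρ (suc i) = refl

mutual
  renV-∘ : ∀ {n m k} (ρ' : Ren m k) (ρ : Ren n m) V → renV ρ' (renV ρ V) ≡ renV (ρ' ∘ ρ) V
  renV-∘ ρ' ρ v* = refl
  renV-∘ ρ' ρ (vvar x) = refl
  renV-∘ ρ' ρ (vlam M) = cong vlam (renT-∘-ext ρ' ρ M)
  renV-∘ ρ' ρ (v! V) = cong v! (renV-∘ ρ' ρ V)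

  renT-∘ : ∀ {n m k} (ρ' : Ren m k) (ρ : Ren n m) M → renT ρ' (renT ρ M) ≡ renT (ρ' ∘ ρ) M
  renT-∘ ρ' ρ `* = refl
  renT-∘ ρ' ρ (`var x) = refl
  renT-∘ ρ' ρ (`lam M) = cong `lam (renT-∘-ext ρ' ρ M)
  renT-∘ ρ' ρ (`app M N) = cong₂ `app (renT-∘ ρ' ρ M) (renT-∘ ρ' ρ N)
  renT-∘ ρ' ρ (`! M) = cong `! (renT-∘ ρ' ρ M)
  renT-∘ ρ' ρ (`let! M N) = cong₂ `let! (renT-∘ ρ' ρ M) (renT-∘-ext ρ' ρ N)
  renT-∘ ρ' ρ (`ν M) = cong `ν (renT-∘-ext ρ' ρ M)
  renT-∘ ρ' ρ (`set x V) = cong (`set _) (renV-∘ ρ' ρ V)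
  renT-∘ ρ' ρ (`pset x V) = cong (`pset _) (renV-∘ ρ' ρ V)
  renT-∘ ρ' ρ (`get x) = refl
  renT-∘ ρ' ρ (`par M N) = cong₂ `par (renT-∘ ρ' ρ M) (renT-∘ ρ' ρ N)

  renT-∘-ext : ∀ {n m k} (ρ' : Ren m k) (ρ : Ren n m) M →
               renT (extR ρ') (renT (extR ρ) M) ≡ renT (extR (ρ' ∘ ρ)) M
  renT-∘-ext ρ' ρ M = trans (renT-∘ (extR ρ') (extR ρ) M) (renT-cong (extR-∘ ρ' ρ) M)

extR-id : ∀ {n} → extR (id {A = Fin n}) ≗ id
extR-id zero = refl
extR-id (suc i) = refl

mutual
  renV-id : ∀ {n} (V : Val n) → renV id V ≡ V
  renV-id v* = refl
  renV-id (vvar x) = refl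
  renV-id (vlam M) = cong vlam (renT-id-ext M)
  renV-id (v! V) = cong v! (renV-id V)

  renT-id : ∀ {n} (M : Term n) → renT id M ≡ M
  renT-id `* = refl
  renT-id (`var x) = refl
  renT-id (`lam M) = cong `lam (renT-id-ext M)
  renT-id (`app M N) = cong₂ `app (renT-id M) (renT-id N)
  renT-id (`! M) = cong `! (renT-id M)
  renT-id (`let! M N) = cong₂ `let! (renT-id M) (renT-id-ext N)
  renT-id (`ν M) = cong `ν (renT-id-ext M)
  renT-id (`set x V) = cong (`set x) (renV-id V)
  renT-id (`pset x V) = cong (`pset x) (renV-id V)
  renT-id (`get x) = refl
  renT-id (`par M N) = cong₂ `par (renT-id M) (renT-id N)

  renT-id-ext : ∀ {n} (M : Term (suc n)) → renT (extR id) M ≡ M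
  renT-id-ext M = trans (renT-cong extR-id M) (renT-id M)

_∘ᴱ_ : ∀ {n} → ECtx n → ECtx n → ECtx n
hole ∘ᴱ E₀ = E₀
appˡ E N ∘ᴱ E₀ = appˡ (E ∘ᴱ E₀) N
appʳ V E ∘ᴱ E₀ = appʳ V (E ∘ᴱ E₀)
bang E ∘ᴱ E₀ = bang (E ∘ᴱ E₀)
let! E N ∘ᴱ E₀ = let! (E ∘ᴱ E₀) N

plug-∘ᴱ : ∀ {n} (E E₀ : ECtx n) M → (E ∘ᴱ E₀) [ M ]ᴱ ≡ E [ E₀ [ M ]ᴱ ]ᴱ
plug-∘ᴱ hole E₀ M = refl
plug-∘ᴱ (appˡ E N) E₀ M = cong (λ X → `app X N) (plug-∘ᴱ E E₀ M)
plug-∘ᴱ (appʳ V E) E₀ M = cong (`app ⌞ V ⌟) (plug-∘ᴱ E E₀ M)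
plug-∘ᴱ (bang E) E₀ M = cong `! (plug-∘ᴱ E E₀ M)
plug-∘ᴱ (let! E N) E₀ M = cong (λ X → `let! X N) (plug-∘ᴱ E E₀ M)

renE-∘ᴱ : ∀ {n m} (ρ : Ren n m) (E E₀ : ECtx n) → renE ρ (E ∘ᴱ E₀) ≡ renE ρ E ∘ᴱ renE ρ E₀
renE-∘ᴱ ρ hole E₀ = refl
renE-∘ᴱ ρ (appˡ E N) E₀ = cong (λ X → appˡ X (renT ρ N)) (renE-∘ᴱ ρ E E₀)
renE-∘ᴱ ρ (appʳ V E) E₀ = cong (appʳ (renV ρ V)) (renE-∘ᴱ ρ E E₀)
renE-∘ᴱ ρ (bang E) E₀ = cong bang (renE-∘ᴱ ρ E E₀)
renE-∘ᴱ ρ (let! E N) E₀ = cong (λ X → let! X (renT (extR ρ) N)) (renE-∘ᴱ ρ E E₀)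

toVal : ∀ {n} → Term n → Maybe (Val n)
toVal `* = just v*
toVal (`var x) = just (vvar x)
toVal (`lam M) = just (vlam M)
toVal (`! M) = Maybe.map v! (toVal M)
toVal _ = nothing

toVal-⌞⌟ : ∀ {n} (V : Val n) → toVal ⌞ V ⌟ ≡ just V
toVal-⌞⌟ v* = refl
toVal-⌞⌟ (vvar x) = refl
toVal-⌞⌟ (vlam M) = refl
toVal-⌞⌟ (v! V) = cong (Maybe.map v!) (toVal-⌞⌟ V)

toVal-plug-get : ∀ {n} (E : ECtx n) y → toVal (E [ `get y ]ᴱ) ≡ nothing
toVal-plug-get hole y = refl
toVal-plug-get (appˡ E N) y = refl
toVal-plug-get (appʳ V E) y = refl
toVal-plug-get (bang E) y = cong (Maybe.map v!) (toVal-plug-get E y)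
toVal-plug-get (let! E N) y = refl

-- The unique decomposition  M = E[get(y)],  when there is one.
focus : ∀ {n} → Term n → Maybe (ECtx n × Fin n)
focus (`get y) = just (hole , y)
focus (`app M N) with toVal M
... | just V = Maybe.map (map₁ (appʳ V)) (focus N)
... | nothing = Maybe.map (map₁ (λ E → appˡ E N)) (focus M)
focus (`! M) = Maybe.map (map₁ bang) (focus M)
focus (`let! M N) = Maybe.map (map₁ (λ E → let! E N)) (focus M)
focus _ = nothing

focus-plug-get : ∀ {n} (E : ECtx n) y → focus (E [ `get y ]ᴱ) ≡ just (E , y)
focus-plug-get hole y = refl
focus-plug-get (appˡ E N) y rewrite toVal-plug-get E y | focus-plug-get E y = refl
focus-plug-get (appʳ V E) y rewrite toVal-⌞⌟ V | focus-plug-get E y = refl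
focus-plug-get (bang E) y rewrite focus-plug-get E y = refl
focus-plug-get (let! E N) y rewrite focus-plug-get E y = refl

plug-get-injective : ∀ {n} {E E' : ECtx n} {y y'} → E [ `get y ]ᴱ ≡ E' [ `get y' ]ᴱ → E ≡ E' × y ≡ y'
plug-get-injective {E = E} {E'} {y} {y'} e = ,-injectiveˡ same , ,-injectiveʳ same
  where
  same : (E , y) ≡ (E' , y')
  same = just-injective (trans (sym (focus-plug-get E y)) (trans (cong focus e) (focus-plug-get E' y')))

≈-setoid : ℕ → Setoid _ _
≈-setoid n = record
  { Carrier = Prog n ; _≈_ = _≈_
  ; isEquivalence = record { refl = ≈-refl ; sym = ≈-sym ; trans = ≈-trans } }

module ≈-Reasoning {n : ℕ} = Relation.Binary.Reasoning.Setoid (≈-setoid n)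

≡⇒≈ : ∀ {n} {P Q : Prog n} → P ≡ Q → P ≈ Q
≡⇒≈ refl = ≈-refl

-- P₁ | ⋯ | Pₖ; the empty composition is a junk value, never used on an empty list.
parAll : ∀ {n} → List (Prog n) → Prog n
parAll [] = tm `*
parAll (P ∷ Ps) = pars P Ps

∷↭[]-absurd : ∀ {A : Set} {x : A} {xs} → ¬ (x ∷ xs ↭ [])
∷↭[]-absurd p with ↭-empty-inv p
... | ()

parAll-prep : ∀ {n} (P : Prog n) {Ps Qs} → Ps ↭ Qs → parAll Ps ≈ parAll Qs → parAll (P ∷ Ps) ≈ parAll (P ∷ Qs)
parAll-prep P {[]} {[]} p q = ≈-refl
parAll-prep P {_ ∷ _} {_ ∷ _} p q = ≈-ctx (parʳ P hole) q
parAll-prep P {[]} {_ ∷ _} p q = ⊥-elim (∷↭[]-absurd (↭.↭-sym p))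
parAll-prep P {_ ∷ _} {[]} p q = ⊥-elim (∷↭[]-absurd p)

parAll-swap : ∀ {n} (P Q : Prog n) {Ps Qs} → Ps ↭ Qs → parAll Ps ≈ parAll Qs →
              parAll (P ∷ Q ∷ Ps) ≈ parAll (Q ∷ P ∷ Qs)
parAll-swap P Q {[]} {[]} p q = ≈-comm
parAll-swap P Q {R ∷ Rs} {R' ∷ Rs'} p q = begin
  par P (par Q (pars R Rs))   ≈⟨ ≈-assoc ⟨
  par (par P Q) (pars R Rs)   ≈⟨ ≈-ctx (parˡ hole _) ≈-comm ⟩
  par (par Q P) (pars R Rs)   ≈⟨ ≈-assoc ⟩
  par Q (par P (pars R Rs))   ≈⟨ ≈-ctx (parʳ Q (parʳ P hole)) q ⟩
  par Q (par P (pars R' Rs')) ∎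
  where open ≈-Reasoning
parAll-swap P Q {[]} {_ ∷ _} p q = ⊥-elim (∷↭[]-absurd (↭.↭-sym p))
parAll-swap P Q {_ ∷ _} {[]} p q = ⊥-elim (∷↭[]-absurd p)

parAll-↭ : ∀ {n} {Ps Qs : List (Prog n)} → Ps ↭ Qs → parAll Ps ≈ parAll Qs
parAll-↭ ↭.refl = ≈-refl
parAll-↭ (↭.prep P p) = parAll-prep P p (parAll-↭ p)
parAll-↭ (↭.swap P Q p) = parAll-swap P Q p (parAll-↭ p)
parAll-↭ (↭.trans p q) = ≈-trans (parAll-↭ p) (parAll-↭ q)

par-pars : ∀ {n} (P : Prog n) Ps Q Qs → par (pars P Ps) (pars Q Qs) ≈ pars P (Ps ++ Q ∷ Qs)
par-pars P [] Q Qs = ≈-refl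
par-pars P (P' ∷ Ps) Q Qs = ≈-trans ≈-assoc (≈-ctx (parʳ P hole) (par-pars P' Ps Q Qs))

NonEmpty : ∀ {A : Set} → List A → Set
NonEmpty {A} xs = Σ A λ x → Σ (List A) λ xs' → xs ≡ x ∷ xs'

par-parAll : ∀ {n} {Ps Qs : List (Prog n)} → NonEmpty Ps → NonEmpty Qs →
             par (parAll Ps) (parAll Qs) ≈ parAll (Ps ++ Qs)
par-parAll (P , Ps , refl) (Q , Qs , refl) = par-pars P Ps Q Qs

Stuck : ∀ {n} → Prog n → Set
Stuck P = ¬ (∃[ P' ] (P ⟶ P'))

stuck-resp-≈ : ∀ {n} {P Q : Prog n} → P ≈ Q → Stuck P → Stuck Q
stuck-resp-≈ p st (P' , m , C , Δ , Δ' , b , e₁ , e₂) = st (P' , m , C , Δ , Δ' , b , ≈-trans p e₁ , e₂)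

stuck-parˡ : ∀ {n} {P Q : Prog n} → Stuck (par P Q) → Stuck P
stuck-parˡ {Q = Q} st (P' , m , C , Δ , Δ' , b , e₁ , e₂) =
  st (par P' Q , m , parˡ C Q , Δ , Δ' , b , ≈-ctx (parˡ hole Q) e₁ , ≈-ctx (parˡ hole Q) e₂)

stuck-parʳ : ∀ {n} {P Q : Prog n} → Stuck (par P Q) → Stuck Q
stuck-parʳ {P = P} st (P' , m , C , Δ , Δ' , b , e₁ , e₂) =
  st (par P P' , m , parʳ P C , Δ , Δ' , b , ≈-ctx (parʳ P hole) e₁ , ≈-ctx (parʳ P hole) e₂)

stuck-ν : ∀ {n} {P : Prog (suc n)} → Stuck (ν P) → Stuck P
stuck-ν st (P' , m , C , Δ , Δ' , b , e₁ , e₂) =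
  st (ν P' , m , ν C , Δ , Δ' , b , ≈-ctx (ν hole) e₁ , ≈-ctx (ν hole) e₂)

stuck-νs : ∀ k {n} {P : Prog (k + n)} → Stuck (νs k P) → Stuck P
stuck-νs zero st = st
stuck-νs (suc k) st = stuck-ν (stuck-νs k st)

redex-¬stuck : ∀ {n} {Δ Δ' : Prog n} → Δ ⇒ᵇ Δ' → ¬ Stuck Δ
redex-¬stuck b st = st (_ , _ , hole , _ , _ , b , ≈-refl , ≈-refl)

infix 4 _≈ᴱ_
_≈ᴱ_ : ∀ {n} → Term n → Term n → Set
_≈ᴱ_ {n} M M' = (E : ECtx n) → tm (E [ M ]ᴱ) ≈ tm (E [ M' ]ᴱ)

≈ᴱ-refl : ∀ {n} {M : Term n} → M ≈ᴱ M
≈ᴱ-refl E = ≈-refl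

≈ᴱ-trans : ∀ {n} {M M' M'' : Term n} → M ≈ᴱ M' → M' ≈ᴱ M'' → M ≈ᴱ M''
≈ᴱ-trans p q E = ≈-trans (p E) (q E)

≈ᴱ-plug : ∀ {n} (E₀ : ECtx n) {M M' : Term n} → M ≈ᴱ M' → E₀ [ M ]ᴱ ≈ᴱ E₀ [ M' ]ᴱ
≈ᴱ-plug E₀ {M} {M'} p E =
  subst₂ _≈_ (cong tm (plug-∘ᴱ E E₀ M)) (cong tm (plug-∘ᴱ E E₀ M')) (p (E ∘ᴱ E₀))

≈ᴱ-extr : ∀ {n} (E₀ : ECtx n) (M : Term (suc n)) → E₀ [ `ν M ]ᴱ ≈ᴱ `ν (renE suc E₀ [ M ]ᴱ)
≈ᴱ-extr E₀ M E = begin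
  tm (E [ E₀ [ `ν M ]ᴱ ]ᴱ)                          ≡⟨ cong tm (plug-∘ᴱ E E₀ (`ν M)) ⟨
  tm ((E ∘ᴱ E₀) [ `ν M ]ᴱ)                          ≈⟨ ≈-extrᴱ ⟩
  tm (`ν (renE suc (E ∘ᴱ E₀) [ M ]ᴱ))               ≡⟨ cong (λ E' → tm (`ν (E' [ M ]ᴱ))) (renE-∘ᴱ suc E E₀) ⟩
  tm (`ν ((renE suc E ∘ᴱ renE suc E₀) [ M ]ᴱ))      ≡⟨ cong (tm ∘ `ν) (plug-∘ᴱ (renE suc E) (renE suc E₀) M) ⟩
  tm (`ν (renE suc E [ renE suc E₀ [ M ]ᴱ ]ᴱ))      ≈⟨ ≈-extrᴱ ⟨
  tm (E [ `ν (renE suc E₀ [ M ]ᴱ) ]ᴱ)               ∎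
  where open ≈-Reasoning

≈ᴱ-ν : ∀ {n} {M M' : Term (suc n)} → M ≈ᴱ M' → `ν M ≈ᴱ `ν M'
≈ᴱ-ν {M = M} {M'} p E = begin
  tm (E [ `ν M ]ᴱ)               ≈⟨ ≈-extrᴱ ⟩
  tm (`ν (renE suc E [ M ]ᴱ))    ≈⟨ ≈-tm-ν ⟩
  ν (tm (renE suc E [ M ]ᴱ))     ≈⟨ ≈-ctx (ν hole) (p (renE suc E)) ⟩
  ν (tm (renE suc E [ M' ]ᴱ))    ≈⟨ ≈-tm-ν ⟨
  tm (`ν (renE suc E [ M' ]ᴱ))   ≈⟨ ≈-extrᴱ ⟨
  tm (E [ `ν M' ]ᴱ)              ∎
  where open ≈-Reasoning

liftPred : ∀ {n} → (Fin n → Set) → Fin (suc n) → Set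
liftPred G zero = ⊤
liftPred G (suc i) = G i

mutual
  AllAddrV : ∀ {n} → (Fin n → Set) → Val n → Set
  AllAddrV G v* = ⊤
  AllAddrV G (vvar x) = ⊤
  AllAddrV G (vlam M) = AllAddr (liftPred G) M
  AllAddrV G (v! V) = AllAddrV G V

  AllAddr : ∀ {n} → (Fin n → Set) → Term n → Set
  AllAddr G `* = ⊤
  AllAddr G (`var x) = ⊤
  AllAddr G (`lam M) = AllAddr (liftPred G) M
  AllAddr G (`app M N) = AllAddr G M × AllAddr G N
  AllAddr G (`! M) = AllAddr G M
  AllAddr G (`let! M N) = AllAddr G M × AllAddr (liftPred G) N
  AllAddr G (`ν M) = AllAddr (liftPred G) M
  AllAddr G (`set x V) = G x × AllAddrV G V
  AllAddr G (`pset x V) = G x × AllAddrV G V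
  AllAddr G (`get x) = G x
  AllAddr G (`par M N) = AllAddr G M × AllAddr G N

liftPred-ren : ∀ {n m} {G : Fin n → Set} {G' : Fin m → Set} {ρ : Ren n m} →
  (∀ i → G i → G' (ρ i)) → ∀ i → liftPred G i → liftPred G' (extR ρ i)
liftPred-ren h zero _ = tt
liftPred-ren h (suc i) g = h i g

mutual
  allAddrV-ren : ∀ {n m} {G : Fin n → Set} {G' : Fin m → Set} (ρ : Ren n m) →
    (∀ i → G i → G' (ρ i)) → ∀ V → AllAddrV G V → AllAddrV G' (renV ρ V)
  allAddrV-ren ρ h v* a = tt
  allAddrV-ren ρ h (vvar x) a = tt
  allAddrV-ren ρ h (vlam M) a = allAddr-ren (extR ρ) (liftPred-ren h) M a
  allAddrV-ren ρ h (v! V) a = allAddrV-ren ρ h V a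

  allAddr-ren : ∀ {n m} {G : Fin n → Set} {G' : Fin m → Set} (ρ : Ren n m) →
    (∀ i → G i → G' (ρ i)) → ∀ M → AllAddr G M → AllAddr G' (renT ρ M)
  allAddr-ren ρ h `* a = tt
  allAddr-ren ρ h (`var x) a = tt
  allAddr-ren ρ h (`lam M) a = allAddr-ren (extR ρ) (liftPred-ren h) M a
  allAddr-ren ρ h (`app M N) (a , b) = allAddr-ren ρ h M a , allAddr-ren ρ h N b
  allAddr-ren ρ h (`! M) a = allAddr-ren ρ h M a
  allAddr-ren ρ h (`let! M N) (a , b) = allAddr-ren ρ h M a , allAddr-ren (extR ρ) (liftPred-ren h) N b
  allAddr-ren ρ h (`ν M) a = allAddr-ren (extR ρ) (liftPred-ren h) M a
  allAddr-ren ρ h (`set x V) (g , a) = h x g , allAddrV-ren ρ h V a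
  allAddr-ren ρ h (`pset x V) (g , a) = h x g , allAddrV-ren ρ h V a
  allAddr-ren ρ h (`get x) g = h x g
  allAddr-ren ρ h (`par M N) (a , b) = allAddr-ren ρ h M a , allAddr-ren ρ h N b

allAddr-mono : ∀ {n} {G G' : Fin n → Set} → (∀ i → G i → G' i) → ∀ M → AllAddr G M → AllAddr G' M
allAddr-mono h M a = subst (AllAddr _) (renT-id M) (allAddr-ren id h M a)

allAddrV-⌞⌟ : ∀ {n} {G : Fin n → Set} V → AllAddr G ⌞ V ⌟ → AllAddrV G V
allAddrV-⌞⌟ v* a = tt
allAddrV-⌞⌟ (vvar x) a = tt
allAddrV-⌞⌟ (vlam M) a = a
allAddrV-⌞⌟ (v! V) a = allAddrV-⌞⌟ V a

IsVar : ∀ {n} → Val n → Set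
IsVar {n} V = ∃[ x ] (V ≡ vvar {n} x)

extS-isVar : ∀ {n m} {G : Fin n → Set} (σ : Sub n m) →
  (∀ i → G i → IsVar (σ i)) → ∀ i → liftPred G i → IsVar (extS σ i)
extS-isVar σ h zero _ = zero , refl
extS-isVar σ h (suc i) g with h i g
... | y , e = suc y , cong (renV suc) e

-- Substitution only fails by putting a non-variable in address position.
mutual
  subV-defined : ∀ {n m} {G : Fin n → Set} (σ : Sub n m) → (∀ i → G i → IsVar (σ i)) →
    ∀ V → AllAddrV G V → ∃[ V' ] (subV σ V ≡ just V')
  subV-defined σ h v* a = v* , refl
  subV-defined σ h (vvar x) a = σ x , refl
  subV-defined σ h (vlam M) a with subT-defined (extS σ) (extS-isVar σ h) M a
  ... | M' , e rewrite e = vlam M' , refl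
  subV-defined σ h (v! V) a with subV-defined σ h V a
  ... | V' , e rewrite e = v! V' , refl

  subT-defined : ∀ {n m} {G : Fin n → Set} (σ : Sub n m) → (∀ i → G i → IsVar (σ i)) →
    ∀ M → AllAddr G M → ∃[ M' ] (subT σ M ≡ just M')
  subT-defined σ h `* a = `* , refl
  subT-defined σ h (`var x) a = ⌞ σ x ⌟ , refl
  subT-defined σ h (`lam M) a with subT-defined (extS σ) (extS-isVar σ h) M a
  ... | M' , e rewrite e = `lam M' , refl
  subT-defined σ h (`app M N) (a , b) with subT-defined σ h M a | subT-defined σ h N b
  ... | M' , e | N' , e' rewrite e | e' = `app M' N' , refl
  subT-defined σ h (`! M) a with subT-defined σ h M a
  ... | M' , e rewrite e = `! M' , refl
  subT-defined σ h (`let! M N) (a , b)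
    with subT-defined σ h M a | subT-defined (extS σ) (extS-isVar σ h) N b
  ... | M' , e | N' , e' rewrite e | e' = `let! M' N' , refl
  subT-defined σ h (`ν M) a with subT-defined (extS σ) (extS-isVar σ h) M a
  ... | M' , e rewrite e = `ν M' , refl
  subT-defined σ h (`set x V) (g , a) with h x g | subV-defined σ h V a
  ... | y , e | V' , e' rewrite e | e' = `set y V' , refl
  subT-defined σ h (`pset x V) (g , a) with h x g | subV-defined σ h V a
  ... | y , e | V' , e' rewrite e | e' = `pset y V' , refl
  subT-defined σ h (`get x) g with h x g
  ... | y , e rewrite e = `get y , refl
  subT-defined σ h (`par M N) (a , b) with subT-defined σ h M a | subT-defined σ h N b
  ... | M' , e | N' , e' rewrite e | e' = `par M' N' , refl

IsReg : VTy → Set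
IsReg A = ∃[ r ] ∃[ B ] (A ≡ Reg r B)

-- Only a bound variable of region type may be used as an address.
Guard : ∀ {n} → VTy → Fin (suc n) → Set
Guard A zero = IsReg A
Guard A (suc i) = ⊤

guard-extR : ∀ {n m} {A} (ρ : Ren n m) i → Guard A i → Guard A (extR ρ i)
guard-extR ρ zero g = g
guard-extR ρ (suc i) g = tt

data Canonical {n : ℕ} : VTy → Val n → Set where
  unit : Canonical 𝟏 v*
  addr : ∀ {r A x} → Canonical (Reg r A) (vvar x)
  lam : ∀ {A α M} → AllAddr (Guard A) M → Canonical (A ⊸ α) (vlam M)
  bang : ∀ {A V} → Canonical A V → Canonical (!ᵗ A) (v! V)

canonical-ren : ∀ {n m A} {V : Val n} (ρ : Ren n m) → Canonical A V → Canonical A (renV ρ V)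
canonical-ren ρ unit = unit
canonical-ren ρ addr = addr
canonical-ren ρ (lam {M = M} a) = lam (allAddr-ren (extR ρ) (guard-extR ρ) M a)
canonical-ren ρ (bang c) = bang (canonical-ren ρ c)

canonical-reg-isVar : ∀ {n A} {V : Val n} → Canonical A V → IsReg A → IsVar V
canonical-reg-isVar (addr {x = x}) _ = x , refl
canonical-reg-isVar unit (_ , _ , ())
canonical-reg-isVar (lam _) (_ , _ , ())
canonical-reg-isVar (bang _) (_ , _ , ())

sub0-defined : ∀ {n A} {W : Val n} M → AllAddr (Guard A) M → Canonical A W → ∃[ M' ] (M [ W /0]≔ M')
sub0-defined {W = W} M a c = subT-defined (sub0 W) isVar M a
  where
  isVar : ∀ i → Guard _ i → IsVar (sub0 W i)
  isVar zero g = canonical-reg-isVar c g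
  isVar (suc i) _ = i , refl

Redex : ∀ {n} → Term n → Set
Redex {n} D = (E : ECtx n) → ∃[ Δ' ] (tm (E [ D ]ᴱ) ⇒ᵇ Δ')

redex-β : ∀ {n A} {M : Term (suc n)} {W} → AllAddr (Guard A) M → Canonical A W → Redex (`app (`lam M) ⌞ W ⌟)
redex-β {M = M} a c E with sub0-defined M a c
... | _ , e = _ , β E _ _ e

redex-β! : ∀ {n A} {N : Term (suc n)} {V} → AllAddr (Guard A) N → Canonical A V → Redex (`let! (`! ⌞ V ⌟) N)
redex-β! {N = N} a c E with sub0-defined N a c
... | _ , e = _ , β! E _ _ e

data TermNF (n : ℕ) : Ty → Set where
  value : ∀ {A} (V : Val n) → Canonical A V → TermNF n ⌜ A ⌝
  waiting : ∀ {α} (E : ECtx n) (y : Fin n) → TermNF n α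
  redex : ∀ {α} (E : ECtx n) (D : Term n) → Redex D → TermNF n α
  new : ∀ {α} → TermNF (suc n) α → TermNF n α

⟦_⟧ᵀ : ∀ {n α} → TermNF n α → Term n
⟦ value V _ ⟧ᵀ = ⌞ V ⌟
⟦ waiting E y ⟧ᵀ = E [ `get y ]ᴱ
⟦ redex E D _ ⟧ᵀ = E [ D ]ᴱ
⟦ new X ⟧ᵀ = `ν ⟦ X ⟧ᵀ

HasNF : ∀ {n} → Ty → Term n → Set
HasNF {n} α M = Σ (TermNF n α) λ X → M ≈ᴱ ⟦ X ⟧ᵀ

-- Normalisable under every renaming, as needed once a ν has been extruded over N.
Normalisable : ∀ {n} → VTy → Term n → Set
Normalisable {n} A N = ∀ {k} (ρ : Ren n k) → HasNF ⌜ A ⌝ (renT ρ N)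

normalisable-shift : ∀ {n A} {N : Term n} → Normalisable A N → Normalisable A (renT suc N)
normalisable-shift {N = N} p ρ with p (ρ ∘ suc)
... | Y , q = Y , subst (_≈ᴱ ⟦ Y ⟧ᵀ) (sym (renT-∘ ρ suc N)) q

normalisable-nf : ∀ {n A} {N : Term n} → Normalisable A N → HasNF ⌜ A ⌝ N
normalisable-nf {N = N} p with p id
... | Y , q = Y , subst (_≈ᴱ ⟦ Y ⟧ᵀ) (renT-id N) q

app-value-nf : ∀ {n A α} (F : Val n) → Canonical (A ⊸ α) F → (Y : TermNF n ⌜ A ⌝) →
  HasNF α (`app ⌞ F ⌟ ⟦ Y ⟧ᵀ)
app-value-nf (vlam M) (lam a) (value W c) = redex hole _ (redex-β a c) , ≈ᴱ-refl
app-value-nf F c (waiting E y) = waiting (appʳ F E) y , ≈ᴱ-refl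
app-value-nf F c (redex E D r) = redex (appʳ F E) D r , ≈ᴱ-refl
app-value-nf F c (new Y) with app-value-nf (renV suc F) (canonical-ren suc c) Y
... | Z , q = new Z , ≈ᴱ-trans (≈ᴱ-extr (appʳ F hole) ⟦ Y ⟧ᵀ) (≈ᴱ-ν q)

app-nf : ∀ {n A α} (X : TermNF n ⌜ A ⊸ α ⌝) (N : Term n) → Normalisable A N → HasNF α (`app ⟦ X ⟧ᵀ N)
app-nf (value F c) N p with normalisable-nf p
... | Y , q with app-value-nf F c Y
... | Z , q' = Z , ≈ᴱ-trans (≈ᴱ-plug (appʳ F hole) q) q'
app-nf (waiting E y) N p = waiting (appˡ E N) y , ≈ᴱ-refl
app-nf (redex E D r) N p = redex (appˡ E N) D r , ≈ᴱ-refl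
app-nf (new X) N p with app-nf X (renT suc N) (normalisable-shift p)
... | Z , q = new Z , ≈ᴱ-trans (≈ᴱ-extr (appˡ hole N) ⟦ X ⟧ᵀ) (≈ᴱ-ν q)

let-nf : ∀ {n A α} (X : TermNF n ⌜ !ᵗ A ⌝) (N : Term (suc n)) → AllAddr (Guard A) N →
  HasNF α (`let! ⟦ X ⟧ᵀ N)
let-nf (value (v! V) (bang c)) N a = redex hole _ (redex-β! a c) , ≈ᴱ-refl
let-nf (waiting E y) N a = waiting (let! E N) y , ≈ᴱ-refl
let-nf (redex E D r) N a = redex (let! E N) D r , ≈ᴱ-refl
let-nf (new X) N a with let-nf X (renT (extR suc) N) (allAddr-ren (extR suc) (guard-extR suc) N a)
... | Z , q = new Z , ≈ᴱ-trans (≈ᴱ-extr (let! hole N) ⟦ X ⟧ᵀ) (≈ᴱ-ν q)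

bang-nf : ∀ {n A} (X : TermNF n ⌜ A ⌝) → HasNF ⌜ !ᵗ A ⌝ (`! ⟦ X ⟧ᵀ)
bang-nf (value V c) = value (v! V) (bang c) , ≈ᴱ-refl
bang-nf (waiting E y) = waiting (bang E) y , ≈ᴱ-refl
bang-nf (redex E D r) = redex (bang E) D r , ≈ᴱ-refl
bang-nf (new X) with bang-nf X
... | Z , q = new Z , ≈ᴱ-trans (≈ᴱ-extr (bang hole) ⟦ X ⟧ᵀ) (≈ᴱ-ν q)

Inert : ∀ {n} → Term n → Set
Inert {n} M = IsValue M ⊎ (Σ (ECtx n) λ E → ∃[ y ] (M ≡ E [ `get y ]ᴱ))

-- A persistent cell holds a promoted value, as (get) on a persistent store requires.
StoreCell : ∀ {n} → Prog n → Set
StoreCell {n} S = (Σ (Fin n) λ x → ∃[ V ] (S ≡ sto x V)) ⊎ (Σ (Fin n) λ x → ∃[ V ] (S ≡ psto x (v! V)))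

record Flat (n : ℕ) : Set where
  constructor flat
  field
    terms : List (Term n)
    stores : List (Prog n)
    inert : All Inert terms
    cells : All StoreCell stores
    nonEmpty : NonEmpty (map tm terms ++ stores)

components : ∀ {n} → Flat n → List (Prog n)
components b = map tm (Flat.terms b) ++ Flat.stores b

data ProgNF (n : ℕ) : Set where
  base : Flat n → ProgNF n
  new : ProgNF (suc n) → ProgNF n

⟦_⟧ᴾ : ∀ {n} → ProgNF n → Prog n
⟦ base b ⟧ᴾ = parAll (components b)
⟦ new X ⟧ᴾ = ν ⟦ X ⟧ᴾ

inert-ren : ∀ {n m} (ρ : Ren n m) {M : Term n} → Inert M → Inert (renT ρ M)
inert-ren ρ (inj₁ (V , refl)) = inj₁ (renV ρ V , renT-⌞⌟ ρ V)
inert-ren ρ (inj₂ (E , y , refl)) = inj₂ (renE ρ E , ρ y , renT-plug ρ E (`get y))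

storeCell-ren : ∀ {n m} (ρ : Ren n m) {S : Prog n} → StoreCell S → StoreCell (renP ρ S)
storeCell-ren ρ (inj₁ (x , V , refl)) = inj₁ (ρ x , renV ρ V , refl)
storeCell-ren ρ (inj₂ (x , V , refl)) = inj₂ (ρ x , renV ρ V , refl)

map-renP-++ : ∀ {n m} (ρ : Ren n m) (Ms : List (Term n)) Ss →
  map (renP ρ) (map tm Ms ++ Ss) ≡ map tm (map (renT ρ) Ms) ++ map (renP ρ) Ss
map-renP-++ ρ [] Ss = refl
map-renP-++ ρ (M ∷ Ms) Ss = cong (tm (renT ρ M) ∷_) (map-renP-++ ρ Ms Ss)

nonEmpty-map : ∀ {A B : Set} (f : A → B) {xs : List A} → NonEmpty xs → NonEmpty (map f xs)
nonEmpty-map f (x , xs , refl) = f x , map f xs , refl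

renFlat : ∀ {n m} (ρ : Ren n m) → Flat n → Flat m
renFlat ρ (flat Ms Ss gM gS ne) =
  flat (map (renT ρ) Ms) (map (renP ρ) Ss) (gmap⁺ (inert-ren ρ) gM) (gmap⁺ (storeCell-ren ρ) gS)
       (subst NonEmpty (map-renP-++ ρ Ms Ss) (nonEmpty-map (renP ρ) ne))

renNF : ∀ {n m} (ρ : Ren n m) → ProgNF n → ProgNF m
renNF ρ (base b) = base (renFlat ρ b)
renNF ρ (new X) = new (renNF (extR ρ) X)

renP-pars : ∀ {n m} (ρ : Ren n m) P Ps → renP ρ (pars P Ps) ≡ pars (renP ρ P) (map (renP ρ) Ps)
renP-pars ρ P [] = refl
renP-pars ρ P (Q ∷ Qs) = cong (par (renP ρ P)) (renP-pars ρ Q Qs)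

renP-parAll : ∀ {n m} (ρ : Ren n m) Ps → renP ρ (parAll Ps) ≡ parAll (map (renP ρ) Ps)
renP-parAll ρ [] = refl
renP-parAll ρ (P ∷ Ps) = renP-pars ρ P Ps

⟦renNF⟧ : ∀ {n m} (ρ : Ren n m) X → ⟦ renNF ρ X ⟧ᴾ ≡ renP ρ ⟦ X ⟧ᴾ
⟦renNF⟧ ρ (base (flat Ms Ss _ _ _)) =
  sym (trans (renP-parAll ρ (map tm Ms ++ Ss)) (cong parAll (map-renP-++ ρ Ms Ss)))
⟦renNF⟧ ρ (new X) = cong ν (⟦renNF⟧ (extR ρ) X)

≡⇒↭ : ∀ {A : Set} {xs ys : List A} → xs ≡ ys → xs ↭ ys
≡⇒↭ refl = ↭.refl

nonEmpty-↭ : ∀ {A : Set} {xs ys : List A} → xs ↭ ys → NonEmpty xs → NonEmpty ys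
nonEmpty-↭ {ys = []} p (x , xs , refl) = ⊥-elim (∷↭[]-absurd p)
nonEmpty-↭ {ys = y ∷ ys} p _ = y , ys , refl

nonEmpty-++ : ∀ {A : Set} {xs : List A} ys → NonEmpty xs → NonEmpty (xs ++ ys)
nonEmpty-++ ys (x , xs , refl) = x , xs ++ ys , refl

components-↭ : ∀ {n} (M₁ M₂ : List (Term n)) (S₁ S₂ : List (Prog n)) →
  (map tm M₁ ++ S₁) ++ (map tm M₂ ++ S₂) ↭ map tm (M₁ ++ M₂) ++ (S₁ ++ S₂)
components-↭ M₁ M₂ S₁ S₂ = ↭.trans (≡⇒↭ (++-assoc a S₁ (c ++ S₂)))
  (↭.trans (++⁺ˡ a (shifts S₁ c))
  (≡⇒↭ (trans (sym (++-assoc a c (S₁ ++ S₂))) (cong (_++ (S₁ ++ S₂)) (sym (map-++ tm M₁ M₂))))))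
  where
  a = map tm M₁
  c = map tm M₂

merge-flat : ∀ {n} (b₁ b₂ : Flat n) →
  Σ (Flat n) λ b → par ⟦ base b₁ ⟧ᴾ ⟦ base b₂ ⟧ᴾ ≈ ⟦ base b ⟧ᴾ
merge-flat (flat M₁ S₁ gM₁ gS₁ ne₁) (flat M₂ S₂ gM₂ gS₂ ne₂) =
  flat (M₁ ++ M₂) (S₁ ++ S₂) (++⁺ gM₁ gM₂) (++⁺ gS₁ gS₂) (nonEmpty-↭ p (nonEmpty-++ _ ne₁)) ,
  ≈-trans (par-parAll ne₁ ne₂) (parAll-↭ p)
  where p = components-↭ M₁ M₂ S₁ S₂

merge-flat-nf : ∀ {n} (b : Flat n) (Y : ProgNF n) → Σ (ProgNF n) λ Z → par ⟦ base b ⟧ᴾ ⟦ Y ⟧ᴾ ≈ ⟦ Z ⟧ᴾ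
merge-flat-nf b (base b') with merge-flat b b'
... | b'' , q = base b'' , q
merge-flat-nf b (new Y) with merge-flat-nf (renFlat suc b) Y
... | Z , q = new Z , (begin
  par ⟦ base b ⟧ᴾ (ν ⟦ Y ⟧ᴾ)                     ≈⟨ ≈-comm ⟩
  par (ν ⟦ Y ⟧ᴾ) ⟦ base b ⟧ᴾ                     ≈⟨ ≈-extr ⟩
  ν (par ⟦ Y ⟧ᴾ (renP suc ⟦ base b ⟧ᴾ))          ≈⟨ ≈-ctx (ν hole) ≈-comm ⟩
  ν (par (renP suc ⟦ base b ⟧ᴾ) ⟦ Y ⟧ᴾ)          ≡⟨ cong (λ T → ν (par T ⟦ Y ⟧ᴾ)) (⟦renNF⟧ suc (base b)) ⟨
  ν (par ⟦ base (renFlat suc b) ⟧ᴾ ⟦ Y ⟧ᴾ)       ≈⟨ ≈-ctx (ν hole) q ⟩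
  ν ⟦ Z ⟧ᴾ                                       ∎)
  where open ≈-Reasoning

merge : ∀ {n} (X Y : ProgNF n) → Σ (ProgNF n) λ Z → par ⟦ X ⟧ᴾ ⟦ Y ⟧ᴾ ≈ ⟦ Z ⟧ᴾ
merge (base b) Y = merge-flat-nf b Y
merge (new X) Y with merge X (renNF suc Y)
... | Z , q = new Z , (begin
  par (ν ⟦ X ⟧ᴾ) ⟦ Y ⟧ᴾ                ≈⟨ ≈-extr ⟩
  ν (par ⟦ X ⟧ᴾ (renP suc ⟦ Y ⟧ᴾ))     ≡⟨ cong (λ T → ν (par ⟦ X ⟧ᴾ T)) (⟦renNF⟧ suc Y) ⟨
  ν (par ⟦ X ⟧ᴾ ⟦ renNF suc Y ⟧ᴾ)      ≈⟨ ≈-ctx (ν hole) q ⟩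
  ν ⟦ Z ⟧ᴾ                             ∎)
  where open ≈-Reasoning

termNF-progNF : ∀ {n α} (X : TermNF n α) → Stuck (tm ⟦ X ⟧ᵀ) →
  Σ (ProgNF n) λ Y → tm ⟦ X ⟧ᵀ ≈ ⟦ Y ⟧ᴾ
termNF-progNF (value V _) st =
  base (flat (⌞ V ⌟ ∷ []) [] (inj₁ (V , refl) ∷ []) [] (_ , [] , refl)) , ≈-refl
termNF-progNF (waiting E y) st =
  base (flat (E [ `get y ]ᴱ ∷ []) [] (inj₂ (E , y , refl) ∷ []) [] (_ , [] , refl)) , ≈-refl
termNF-progNF (redex E D r) st = ⊥-elim (redex-¬stuck (proj₂ (r E)) st)
termNF-progNF (new X) st with termNF-progNF X (stuck-ν (stuck-resp-≈ ≈-tm-ν st))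
... | Y , q = new Y , ≈-trans ≈-tm-ν (≈-ctx (ν hole) q)

stuck-term-nf : ∀ {n α} {M : Term n} → HasNF α M → Stuck (tm M) → Σ (ProgNF n) λ Y → tm M ≈ ⟦ Y ⟧ᴾ
stuck-term-nf (X , q) st with termNF-progNF X (stuck-resp-≈ (q hole) st)
... | Y , r = Y , ≈-trans (q hole) r

stuck-par-nf : ∀ {n} {P Q : Prog n} → Stuck (par P Q) →
  (Stuck P → Σ (ProgNF n) λ X → P ≈ ⟦ X ⟧ᴾ) → (Stuck Q → Σ (ProgNF n) λ X → Q ≈ ⟦ X ⟧ᴾ) →
  Σ (ProgNF n) λ X → par P Q ≈ ⟦ X ⟧ᴾ
stuck-par-nf st f g with f (stuck-parˡ st) | g (stuck-parʳ st)
... | X₁ , q₁ | X₂ , q₂ with merge X₁ X₂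
... | Z , r = Z , ≈-trans (≈-trans (≈-ctx (parˡ hole _) q₁) (≈-ctx (parʳ _ hole) q₂)) r

AllReg : ∀ {n} → Ctx n → Set
AllReg Γ = ∀ i h → Γ i ≡ just h → ∃[ r ] ∃[ A ] (proj₂ h ≡ Reg r A)

RegAt : ∀ {n} → Ctx n → Fin n → Set
RegAt Γ i = Σ VUse λ u → Σ Region λ r → ∃[ A ] (Γ i ≡ just (u , Reg r A))

hypSumˡ : ∀ {a b c u A} → VHypSum a b c → a ≡ just (u , A) → ∃[ u' ] (c ≡ just (u' , A))
hypSumˡ (left _) refl = _ , refl
hypSumˡ (both _) refl = _ , refl

hypSumʳ : ∀ {a b c u A} → VHypSum a b c → b ≡ just (u , A) → ∃[ u' ] (c ≡ just (u' , A))
hypSumʳ (right _) refl = _ , refl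
hypSumʳ (both _) refl = _ , refl

⊎ᶜ-hypˡ : ∀ {n} {Γ₁ Γ₂ Γ : Ctx n} {i u A} → Γ₁ ⊎ᶜ Γ₂ ≔ Γ → Γ₁ i ≡ just (u , A) →
  ∃[ u' ] (Γ i ≡ just (u' , A))
⊎ᶜ-hypˡ {i = i} s = hypSumˡ (s i)

⊎ᶜ-hypʳ : ∀ {n} {Γ₁ Γ₂ Γ : Ctx n} {i u A} → Γ₁ ⊎ᶜ Γ₂ ≔ Γ → Γ₂ i ≡ just (u , A) →
  ∃[ u' ] (Γ i ≡ just (u' , A))
⊎ᶜ-hypʳ {i = i} s = hypSumʳ (s i)

allReg-⊎ˡ : ∀ {n} {Γ₁ Γ₂ Γ : Ctx n} → AllReg Γ → Γ₁ ⊎ᶜ Γ₂ ≔ Γ → AllReg Γ₁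
allReg-⊎ˡ ar s i (u , A) e = ar i (_ , A) (proj₂ (⊎ᶜ-hypˡ s e))

allReg-⊎ʳ : ∀ {n} {Γ₁ Γ₂ Γ : Ctx n} → AllReg Γ → Γ₁ ⊎ᶜ Γ₂ ≔ Γ → AllReg Γ₂
allReg-⊎ʳ ar s i (u , A) e = ar i (_ , A) (proj₂ (⊎ᶜ-hypʳ s e))

allReg-▷ : ∀ {n} {Γ : Ctx n} {u r A} → AllReg Γ → AllReg (Γ ▷ (u , Reg r A))
allReg-▷ ar zero _ refl = _ , _ , refl
allReg-▷ ar (suc i) h e = ar i h e

regAt-⊎ˡ : ∀ {n} {Γ₁ Γ₂ Γ : Ctx n} → Γ₁ ⊎ᶜ Γ₂ ≔ Γ → ∀ i → RegAt Γ₁ i → RegAt Γ i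
regAt-⊎ˡ s i (_ , _ , _ , e) = _ , _ , _ , proj₂ (⊎ᶜ-hypˡ s e)

regAt-⊎ʳ : ∀ {n} {Γ₁ Γ₂ Γ : Ctx n} → Γ₁ ⊎ᶜ Γ₂ ≔ Γ → ∀ i → RegAt Γ₂ i → RegAt Γ i
regAt-⊎ʳ s i (_ , _ , _ , e) = _ , _ , _ , proj₂ (⊎ᶜ-hypʳ s e)

regAt-▷ : ∀ {n} {Γ : Ctx n} {G : Fin n → Set} {h} → (∀ i → RegAt Γ i → G i) →
  ∀ i → RegAt (Γ ▷ h) i → liftPred G i
regAt-▷ f zero _ = tt
regAt-▷ f (suc i) r = f i r

regAt-guard : ∀ {n} {Γ : Ctx n} {u A} → ∀ i → RegAt (Γ ▷ (u , A)) i → Guard A i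
regAt-guard zero (_ , _ , _ , refl) = _ , _ , refl
regAt-guard (suc i) _ = tt

[↦]-self : ∀ {n} (x : Fin n) h → [ x ↦ h ] x ≡ just h
[↦]-self x h with x Fin.≟ x
... | yes _ = refl
... | no x≢x = ⊥-elim (x≢x refl)

module Typed (κ : Region → Kind) where

  _⨾_⊩_∶_ : ∀ {n} → RCtx → Ctx n → Prog n → Ty → Set
  R ⨾ Γ ⊩ P ∶ α = _⨾_⊢_∶_ κ R Γ P α

  typed-allAddr : ∀ {n R} {Γ : Ctx n} {α} (M : Term n) → R ⨾ Γ ⊩ tm M ∶ α → AllAddr (RegAt Γ) M
  typed-allAddr _ (t-var _ _) = tt
  typed-allAddr _ (t-unit _) = tt
  typed-allAddr (`lam M) (t-abs d) = allAddr-mono (regAt-▷ λ _ → id) M (typed-allAddr M d)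
  typed-allAddr (`app M N) (t-app _ sΓ d₁ d₂) =
    allAddr-mono (regAt-⊎ˡ sΓ) M (typed-allAddr M d₁) , allAddr-mono (regAt-⊎ʳ sΓ) N (typed-allAddr N d₂)
  typed-allAddr (`! M) (t-prom _ sΓ _ _ d _) = allAddr-mono (regAt-⊎ˡ sΓ) M (typed-allAddr M d)
  typed-allAddr (`let! M N) (t-let _ sΓ d₁ d₂) =
    allAddr-mono (regAt-⊎ˡ sΓ) M (typed-allAddr M d₁) ,
    allAddr-mono (regAt-▷ (regAt-⊎ʳ sΓ)) N (typed-allAddr N d₂)
  typed-allAddr (`ν M) (t-newᵗ d) = allAddr-mono (regAt-▷ λ _ → id) M (typed-allAddr M d)
  typed-allAddr _ (t-get _ e _ _) = _ , _ , _ , e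
  typed-allAddr (`set x V) (t-set sΓ _ _ _ _ d) =
    regAt-⊎ˡ sΓ x (_ , _ , _ , [↦]-self x _) ,
    allAddrV-⌞⌟ V (allAddr-mono (regAt-⊎ʳ sΓ) ⌞ V ⌟ (typed-allAddr ⌞ V ⌟ d))
  typed-allAddr (`pset x V) (t-pset sΓ _ _ _ _ d) =
    regAt-⊎ˡ sΓ x (_ , _ , _ , [↦]-self x _) ,
    allAddrV-⌞⌟ V (allAddr-mono (regAt-⊎ʳ sΓ) ⌞ V ⌟ (typed-allAddr ⌞ V ⌟ d))
  typed-allAddr (`par M N) (t-parᵗ _ sΓ d₁ d₂) =
    allAddr-mono (regAt-⊎ˡ sΓ) M (typed-allAddr M d₁) , allAddr-mono (regAt-⊎ʳ sΓ) N (typed-allAddr N d₂)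

  typed-body-guard : ∀ {n R} {Γ : Ctx n} {u A α} (M : Term (suc n)) →
    R ⨾ (Γ ▷ (u , A)) ⊩ tm M ∶ α → AllAddr (Guard A) M
  typed-body-guard M d = allAddr-mono regAt-guard M (typed-allAddr M d)

  typed-bang-value : ∀ {n R} {Γ : Ctx n} {A} V → R ⨾ Γ ⊩ tm ⌞ V ⌟ ∶ ⌜ !ᵗ A ⌝ → AllReg Γ →
    ∃[ V' ] (V ≡ v! V')
  typed-bang-value (vvar x) (t-var _ e) ar with ar x _ e
  ... | _ , _ , ()
  typed-bang-value (v! V) d ar = V , refl

  hasNF-plug : ∀ {n α β} (E₀ : ECtx n) {M : Term n} → HasNF β M →
    ((X : TermNF n β) → HasNF α (E₀ [ ⟦ X ⟧ᵀ ]ᴱ)) → HasNF α (E₀ [ M ]ᴱ)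
  hasNF-plug E₀ (X , q) f = let Z , q' = f X in Z , ≈ᴱ-trans (≈ᴱ-plug E₀ q) q'

  mutual
    normalise : ∀ {n k R} {Γ : Ctx n} {M A} (ρ : Ren n k) → R ⨾ Γ ⊩ tm M ∶ ⌜ A ⌝ → AllReg Γ →
      HasNF ⌜ A ⌝ (renT ρ M)
    normalise ρ (t-var {x = x} _ e) ar with ar x _ e
    ... | _ , _ , refl = value (vvar (ρ x)) addr , ≈ᴱ-refl
    normalise ρ (t-unit _) ar = value v* unit , ≈ᴱ-refl
    normalise ρ (t-abs {M = M} d) ar =
      value (vlam (renT (extR ρ) M)) (lam (allAddr-ren (extR ρ) (guard-extR ρ) M (typed-body-guard M d))) ,
      ≈ᴱ-refl
    normalise ρ (t-app _ sΓ d₁ d₂) ar = normalise-app ρ sΓ d₁ d₂ ar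
    normalise ρ (t-prom _ sΓ _ _ d _) ar =
      hasNF-plug (bang hole) (normalise ρ d (allReg-⊎ˡ ar sΓ)) bang-nf
    normalise ρ (t-let _ sΓ d₁ d₂) ar = normalise-let ρ sΓ d₁ d₂ ar
    normalise ρ (t-newᵗ d) ar = let X , q = normalise (extR ρ) d (allReg-▷ ar) in new X , ≈ᴱ-ν q
    normalise ρ (t-get {x = x} _ _ _ _) ar = waiting hole (ρ x) , ≈ᴱ-refl
    normalise ρ (t-set {x = x} {V = V} _ _ _ _ _ _) ar =
      redex hole _ (λ E → _ , set E (ρ x) (renV ρ V)) , ≈ᴱ-refl
    normalise ρ (t-pset {x = x} {V = V} _ _ _ _ _ _) ar =
      redex hole _ (λ E → _ , pset E (ρ x) (renV ρ V)) , ≈ᴱ-refl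

    normalisable : ∀ {n k R} {Γ : Ctx n} {N A} → R ⨾ Γ ⊩ tm N ∶ ⌜ A ⌝ → AllReg Γ →
      (ρ : Ren n k) → Normalisable A (renT ρ N)
    normalisable {N = N} d ar ρ ρ' =
      let Y , q = normalise (ρ' ∘ ρ) d ar in Y , subst (_≈ᴱ ⟦ Y ⟧ᵀ) (sym (renT-∘ ρ' ρ N)) q

    normalise-app : ∀ {n k R₁ R₂} {Γ₁ Γ₂ Γ : Ctx n} {M N A α} (ρ : Ren n k) → Γ₁ ⊎ᶜ Γ₂ ≔ Γ →
      R₁ ⨾ Γ₁ ⊩ tm M ∶ ⌜ A ⊸ α ⌝ → R₂ ⨾ Γ₂ ⊩ tm N ∶ ⌜ A ⌝ → AllReg Γ →
      HasNF α (renT ρ (`app M N))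
    normalise-app {N = N} ρ sΓ d₁ d₂ ar =
      hasNF-plug (appˡ hole (renT ρ N)) (normalise ρ d₁ (allReg-⊎ˡ ar sΓ)) λ X →
        app-nf X (renT ρ N) (normalisable d₂ (allReg-⊎ʳ ar sΓ) ρ)

    normalise-let : ∀ {n k R₁ R₂} {Γ₁ Γ₂ Γ : Ctx n} {M N A α} (ρ : Ren n k) → Γ₁ ⊎ᶜ Γ₂ ≔ Γ →
      R₁ ⨾ Γ₁ ⊩ tm M ∶ ⌜ !ᵗ A ⌝ → R₂ ⨾ (Γ₂ ▷ (inf , A)) ⊩ tm N ∶ α → AllReg Γ →
      HasNF α (renT ρ (`let! M N))
    normalise-let {N = N} ρ sΓ d₁ d₂ ar =
      hasNF-plug (let! hole (renT (extR ρ) N)) (normalise ρ d₁ (allReg-⊎ˡ ar sΓ)) λ X →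
        let-nf X (renT (extR ρ) N) (allAddr-ren (extR ρ) (guard-extR ρ) N (typed-body-guard N d₂))

  unrename : ∀ {n α} {M : Term n} → HasNF α (renT id M) → HasNF α M
  unrename {α = α} {M} = subst (HasNF α) (renT-id M)

  stuck-typed-nf : ∀ {n R} {Γ : Ctx n} {P α} → R ⨾ Γ ⊩ P ∶ α → AllReg Γ → Stuck P →
    Σ (ProgNF n) λ X → P ≈ ⟦ X ⟧ᴾ
  stuck-typed-nf d@(t-var _ _) ar = stuck-term-nf (unrename (normalise id d ar))
  stuck-typed-nf d@(t-unit _) ar = stuck-term-nf (unrename (normalise id d ar))
  stuck-typed-nf d@(t-abs _) ar = stuck-term-nf (unrename (normalise id d ar))
  stuck-typed-nf d@(t-prom _ _ _ _ _ _) ar = stuck-term-nf (unrename (normalise id d ar))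
  stuck-typed-nf d@(t-get _ _ _ _) ar = stuck-term-nf (unrename (normalise id d ar))
  stuck-typed-nf d@(t-set _ _ _ _ _ _) ar = stuck-term-nf (unrename (normalise id d ar))
  stuck-typed-nf d@(t-pset _ _ _ _ _ _) ar = stuck-term-nf (unrename (normalise id d ar))
  stuck-typed-nf (t-app _ sΓ d₁ d₂) ar = stuck-term-nf (unrename (normalise-app id sΓ d₁ d₂ ar))
  stuck-typed-nf (t-let _ sΓ d₁ d₂) ar = stuck-term-nf (unrename (normalise-let id sΓ d₁ d₂ ar))
  stuck-typed-nf (t-newᵗ d) ar st =
    let X , q = stuck-typed-nf d (allReg-▷ ar) (stuck-ν (stuck-resp-≈ ≈-tm-ν st)) in
    new X , ≈-trans ≈-tm-ν (≈-ctx (ν hole) q)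
  stuck-typed-nf (t-new d) ar st =
    let X , q = stuck-typed-nf d (allReg-▷ ar) (stuck-ν st) in new X , ≈-ctx (ν hole) q
  stuck-typed-nf (t-parᵗ _ sΓ d₁ d₂) ar st =
    let X , q = stuck-par-nf (stuck-resp-≈ ≈-tm-par st)
                  (stuck-typed-nf d₁ (allReg-⊎ˡ ar sΓ)) (stuck-typed-nf d₂ (allReg-⊎ʳ ar sΓ)) in
    X , ≈-trans ≈-tm-par q
  stuck-typed-nf (t-par _ sΓ _ _ d₁ d₂) ar st =
    stuck-par-nf st (stuck-typed-nf d₁ (allReg-⊎ˡ ar sΓ)) (stuck-typed-nf d₂ (allReg-⊎ʳ ar sΓ))
  stuck-typed-nf (t-par-storeʳ _ sΓ _ d₁ d₂) ar st =
    stuck-par-nf st (stuck-typed-nf d₁ (allReg-⊎ˡ ar sΓ)) (stuck-typed-nf d₂ (allReg-⊎ʳ ar sΓ))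
  stuck-typed-nf (t-par-storeˡ _ sΓ _ d₁ d₂) ar st =
    stuck-par-nf st (stuck-typed-nf d₂ (allReg-⊎ʳ ar sΓ)) (stuck-typed-nf d₁ (allReg-⊎ˡ ar sΓ))
  stuck-typed-nf (t-sto {x = x} {V = V} _ _ _ _ _ _) ar st =
    base (flat [] (sto x V ∷ []) [] (inj₁ (x , V , refl) ∷ []) (_ , [] , refl)) , ≈-refl
  stuck-typed-nf (t-psto {x = x} {V = V} sΓ _ _ _ _ d) ar st with typed-bang-value V d (allReg-⊎ʳ ar sΓ)
  ... | V' , refl = base (flat [] (psto x (v! V') ∷ []) [] (inj₂ (x , V' , refl) ∷ []) (_ , [] , refl)) , ≈-refl

Decomposition : ∀ {n} → Prog n → Set
Decomposition {n} P =
  Σ ℕ λ m → Σ (List (Term (m + n))) λ Ms → Σ (List (Prog (m + n))) λ Ss →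
    Σ (Prog (m + n)) λ Q → Σ (List (Prog (m + n))) λ Qs →
      (map tm Ms ++ Ss ≡ Q ∷ Qs)
      × (P ≈ νs m (pars Q Qs))
      × All IsStore Ss
      × All (λ M → IsValue M ⊎ StuckOnGet Ss M) Ms

decomposition-resp-≈ : ∀ {n} {P P' : Prog n} → P ≈ P' → Decomposition P' → Decomposition P
decomposition-resp-≈ p (m , Ms , Ss , Q , Qs , e , q , s , t) = m , Ms , Ss , Q , Qs , e , ≈-trans p q , s , t

∈⇒↭∷ : ∀ {A : Set} {x : A} {xs} → x ∈ xs → ∃[ ys ] (xs ↭ x ∷ ys)
∈⇒↭∷ {x = x} x∈ with ∈-∃++ x∈
... | ys , zs , refl = ys ++ zs , shift x ys zs

∈×∈⇒↭∷∷ : ∀ {A : Set} {x y : A} {xs} → x ∈ xs → y ∈ xs → y ≢ x → ∃[ ys ] (xs ↭ x ∷ y ∷ ys)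
∈×∈⇒↭∷∷ {x = x} x∈ y∈ y≢x with ∈⇒↭∷ x∈
... | ys , p with ∈-resp-↭ p y∈
... | here y≡x = ⊥-elim (y≢x y≡x)
... | there y∈ys with ∈⇒↭∷ y∈ys
... | zs , p' = zs , ↭.trans p (↭.prep x p')

stuck-head-pair : ∀ {n} (P Q : Prog n) Rs {Δ'} → par P Q ⇒ᵇ Δ' → ¬ Stuck (parAll (P ∷ Q ∷ Rs))
stuck-head-pair P Q [] b st = redex-¬stuck b st
stuck-head-pair P Q (R ∷ Rs) b st = redex-¬stuck b (stuck-parˡ (stuck-resp-≈ (≈-sym ≈-assoc) st))

storeCell-get : ∀ {n} {S : Prog n} {y} → StoreCell S → Binds y S → (E : ECtx n) →
  ∃[ Δ' ] (par (tm (E [ `get y ]ᴱ)) S ⇒ᵇ Δ')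
storeCell-get (inj₁ (_ , _ , refl)) (binds-sto V) E = _ , get E _ V
storeCell-get (inj₂ (_ , V , refl)) (binds-psto _) E = _ , pget E _ V

storeCell-isStore : ∀ {n} {S : Prog n} → StoreCell S → IsStore S
storeCell-isStore (inj₁ (x , V , refl)) = sto-store x V
storeCell-isStore (inj₂ (x , V , refl)) = psto-store x (v! V)

storeCell-≢-tm : ∀ {n} {S : Prog n} {M} → StoreCell S → S ≢ tm M
storeCell-≢-tm (inj₁ (_ , _ , refl)) ()
storeCell-≢-tm (inj₂ (_ , _ , refl)) ()

-- A store for y could be brought next to E[get(y)] and read.
inert-classify : ∀ {n} (Ms : List (Term n)) (Ss : List (Prog n)) → All StoreCell Ss →
  Stuck (parAll (map tm Ms ++ Ss)) → ∀ {M} → M ∈ Ms → Inert M → IsValue M ⊎ StuckOnGet Ss M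
inert-classify Ms Ss cells st M∈ (inj₁ v) = inj₁ v
inert-classify Ms Ss cells st M∈ (inj₂ (E , y , refl)) =
  inj₂ (E , y , refl , (λ E' y' e → plug-get-injective (sym e)) , unbound)
  where
  unbound : ∀ {S} → S ∈ Ss → ¬ Binds y S
  unbound S∈ b with All.lookup cells S∈
  ... | c with ∈×∈⇒↭∷∷ (∈-++⁺ˡ (∈-map⁺ tm M∈)) (∈-++⁺ʳ (map tm Ms) S∈) (storeCell-≢-tm c)
  ... | Rs , p = stuck-head-pair _ _ Rs (proj₂ (storeCell-get c b E)) (stuck-resp-≈ (parAll-↭ p) st)

progNF-decomposition : ∀ k {n} (X : ProgNF (k + n)) → Stuck (νs k ⟦ X ⟧ᴾ) → Decomposition (νs k ⟦ X ⟧ᴾ)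
progNF-decomposition k (new Y) st = progNF-decomposition (suc k) Y st
progNF-decomposition k (base (flat Ms Ss inert cells (Q , Qs , e))) st =
  k , Ms , Ss , Q , Qs , e , ≡⇒≈ (cong (νs k ∘ parAll) e) , All.map storeCell-isStore cells ,
  All.tabulate (λ M∈ → inert-classify Ms Ss cells (stuck-νs k st) M∈ (All.lookup inert M∈))

mainTheorem4 : (κ : Region → Kind) {n : ℕ} (R : RCtx) (Γ : Ctx n) (P : Prog n) (α : Ty) →
    FiniteSupport R →
    (∀ i h → Γ i ≡ just h → ∃[ r ] ∃[ A ] (proj₂ h ≡ Reg r A)) →
    _⨾_⊢_∶_ κ R Γ P α →
    ¬ (∃[ P' ] (P ⟶ P')) →
    Σ ℕ λ m → Σ (List (Term (m + n))) λ Ms → Σ (List (Prog (m + n))) λ Ss →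
      Σ (Prog (m + n)) λ Q → Σ (List (Prog (m + n))) λ Qs →
        (map tm Ms ++ Ss ≡ Q ∷ Qs)
        × (P ≈ νs m (pars Q Qs))
        × All IsStore Ss
        × All (λ M → IsValue M ⊎ StuckOnGet Ss M) Ms
mainTheorem4 κ R Γ P α _ allReg d stuck =
  let X , P≈X = Typed.stuck-typed-nf κ d allReg stuck in
  decomposition-resp-≈ P≈X (progNF-decomposition 0 X (stuck-resp-≈ P≈X stuck))
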